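{- Let $\mathbb F$ be a finite field with $q$ elements, $k\in\mathbb Z$ and $i\ge 0$ an integer. Let $\mathrm{GL}_2(\mathbb F)$ act on $\mathbb F(z)$ by $(f|_\gamma)(z)=(a+cz)^{ -k}f(\frac{b+dz}{a+cz})$ for $\gamma=\begin{pmatrix}a&b\\c&d\end{pmatrix}$. (a) If $k$ is even and $t=\frac{(q-1)k}{2}-i(q+1)\ge0$, then as $\mathrm{GL}_2(\mathbb F)$-representations $$\mathrm{Sym}^t_{\mathbb F}(\mathrm{St})[i-\tfrac k2]\cong H^0\Big(\mathbb P^1_{\mathbb F},\mathcal L\big(\textstyle\sum_{b\in\mathbb F}(\frac k2-i).b-(\frac k2+i).\infty\big)\Big).$$ (b) If $k$ is odd and $t=\frac{(q-1)k-(q+1)}{2}-i(q+1)\ge0$, then as $\mathrm{GL}_2(\mathbb F)$-representations $$\mathrm{Sym}^t_{\mathbb F}(\mathrm{St})[i-\tfrac{k-1}2]\cong H^0\Big(\mathbb P^1_{\mathbb F},\mathcal L\big(\textstyle\sum_{b\in\mathbb F}(\frac{k-1}2-i).b-(\frac{k+1}2+i).\infty\big)\Big).$$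
   Context: $\mathbb P^1_{\mathbb F}=\mathrm{Spec}(\mathbb F[z])\cup\{\infty\}$ with function field $\mathbb F(z)$. For a divisor $D$, $H^0(\mathbb P^1_{\mathbb F},\mathcal L(D))=\{f\in\mathbb F(z):f=0\text{ or }\mathrm{div}(f)+D\ge0\}$, viewed inside $\mathbb F(z)$ with the displayed action (the divisors in question are stable under it). For a commutative ring $A$ and integers $n\ge0$, $s$, $\mathrm{Sym}^n_A(\mathrm{St})[s]$ is the free $A$-module of homogeneous polynomials $F(X,Y)$ of degree $n$ over $A$ with $\mathrm{GL}_2(A)$-action $\gamma.F(X,Y)=(ad-bc)^sF(dX+bY,cX+aY)$. -}

module Defs where

open import Data.Nat as ℕ using (ℕ; zero; suc; _∸_)
open import Data.Integer as ℤ using (ℤ; +_; -[1+_])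
open import Data.Fin using (Fin; toℕ)
open import Data.List using (List; []; _∷_; length)
import Data.List as List
open import Data.Vec as Vec using (Vec)
open import Data.Product using (Σ; _×_; _,_)
open import Data.Sum using (_⊎_)
open import Relation.Binary.PropositionalEquality using (_≡_)
open import Relation.Nullary using (¬_; Dec)
open import Algebra.Structures using (IsCommutativeRing)
open import Function.Bundles using (_↔_)

record FiniteField (q : ℕ) : Set₁ where
  infixl 6 _+_
  infixl 7 _*_
  field
    Carrier : Set
    _+_ _*_ : Carrier → Carrier → Carrier
    -_ : Carrier → Carrier
    0# 1# : Carrier
    isCommutativeRing : IsCommutativeRing _≡_ _+_ _*_ -_ 0# 1#
    0≢1 : ¬ (0# ≡ 1#)
    inv : (x : Carrier) → ¬ (x ≡ 0#) → Carrier
    inv-correct : (x : Carrier) (x≢0 : ¬ (x ≡ 0#)) → x * inv x x≢0 ≡ 1#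
    _≟_ : (x y : Carrier) → Dec (x ≡ y)
    enumeration : Carrier ↔ Fin q

module FF {q : ℕ} (𝔽 : FiniteField q) where
  open FiniteField 𝔽

  -- Polynomials in F[z] as coefficient lists (index = power of z)
  Poly : Set
  Poly = List Carrier

  coeff : Poly → ℕ → Carrier
  coeff [] _ = 0#
  coeff (a ∷ p) zero = a
  coeff (a ∷ p) (suc j) = coeff p j

  infix 4 _≈ₚ_
  _≈ₚ_ : Poly → Poly → Set
  p ≈ₚ r = ∀ j → coeff p j ≡ coeff r j

  0ₚ : Poly
  0ₚ = []

  infixl 6 _+ₚ_
  _+ₚ_ : Poly → Poly → Poly
  [] +ₚ r = r
  (a ∷ p) +ₚ [] = a ∷ p
  (a ∷ p) +ₚ (b ∷ r) = (a + b) ∷ (p +ₚ r)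

  infixl 7 _·ₚ_ _*ₚ_
  _·ₚ_ : Carrier → Poly → Poly
  c ·ₚ p = List.map (c *_) p

  _*ₚ_ : Poly → Poly → Poly
  [] *ₚ r = []
  (a ∷ p) *ₚ r = (a ·ₚ r) +ₚ (0# ∷ (p *ₚ r))

  infixr 8 _^ₚ_
  _^ₚ_ : Poly → ℕ → Poly
  p ^ₚ zero = 1# ∷ []
  p ^ₚ suc n = p *ₚ (p ^ₚ n)

  lin : Carrier → Carrier → Poly
  lin u v = u ∷ v ∷ []

  Σₚ : ℕ → (ℕ → Poly) → Poly
  Σₚ zero f = []
  Σₚ (suc n) f = Σₚ n f +ₚ f n

  homog : Poly → ℕ → Poly → Poly → Poly
  homog p N u w = Σₚ (suc N) (λ j → coeff p j ·ₚ ((u ^ₚ j) *ₚ (w ^ₚ (N ∸ j))))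

  _∣ₚ_ : Poly → Poly → Set
  p ∣ₚ r = Σ Poly (λ s → r ≈ₚ p *ₚ s)

  HasDeg : Poly → ℕ → Set
  HasDeg p n = ¬ (coeff p n ≡ 0#) × (∀ j → n ℕ.< j → coeff p j ≡ 0#)

  IsConstant : Poly → Set
  IsConstant p = ∀ j → 0 ℕ.< j → coeff p j ≡ 0#

  -- closed points of Spec F[z]: monic irreducible polynomials
  MonicIrreducible : Poly → Set
  MonicIrreducible p =
    Σ ℕ (λ n → HasDeg p (suc n) × coeff p (suc n) ≡ 1#
      × (∀ r s → p ≈ₚ r *ₚ s → IsConstant r ⊎ IsConstant s))

  record RatFun : Set where
    constructor _/_
    field
      num den : Poly
  open RatFun public

  IsRatFun : RatFun → Set
  IsRatFun f = ¬ (den f ≈ₚ 0ₚ)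

  infix 4 _≈ᵣ_
  _≈ᵣ_ : RatFun → RatFun → Set
  f ≈ᵣ g = num f *ₚ den g ≈ₚ num g *ₚ den f

  _+ᵣ_ : RatFun → RatFun → RatFun
  (g / h) +ᵣ (g' / h') = ((g *ₚ h') +ₚ (g' *ₚ h)) / (h *ₚ h')

  _·ᵣ_ : Carrier → RatFun → RatFun
  c ·ᵣ (g / h) = (c ·ₚ g) / h

  -- v_p(f) ≥ n  (p a closed point of Spec F[z]):
  -- for f = g/h, every e with p^e ∣ h satisfies p^(e+n) ∣ g (when e+n ≥ 0)
  ValGe : Poly → RatFun → ℤ → Set
  ValGe p (g / h) n =
    ∀ (e e' : ℕ) → (p ^ₚ e) ∣ₚ h → + e' ≡ + e ℤ.+ n → (p ^ₚ e') ∣ₚ g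

  -- v_∞(f) ≥ n, where v_∞(g/h) = deg h - deg g
  ValInfGe : RatFun → ℤ → Set
  ValInfGe (g / h) n =
    g ≈ₚ 0ₚ ⊎ Σ ℕ (λ dg → Σ ℕ (λ dh →
      HasDeg g dg × HasDeg h dh × (+ dg ℤ.+ n ℤ.≤ + dh)))

  -- coefficient c of the divisor Σ_{b∈F} m.b - n.∞ at the finite closed point p
  DivCoeff : ℤ → Poly → ℤ → Set
  DivCoeff m p c =
    Σ Carrier (λ b → (p ≈ₚ lin (- b) 1#) × c ≡ m)
    ⊎ ((∀ b → ¬ (p ≈ₚ lin (- b) 1#)) × c ≡ + 0)

  -- f ∈ H^0(P^1, L(Σ_{b∈F} m.b - n.∞))
  InH0 : ℤ → ℤ → RatFun → Set
  InH0 m n f =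
    IsRatFun f
    × (∀ p → MonicIrreducible p → ∀ c → DivCoeff m p c → ValGe p f (ℤ.- c))
    × ValInfGe f n

  record GL2 : Set where
    field
      a b c d : Carrier
      det≢0 : ¬ (a * d + - (b * c) ≡ 0#)

  det : GL2 → Carrier
  det γ = GL2.a γ * GL2.d γ + - (GL2.b γ * GL2.c γ)

  _^_ : Carrier → ℕ → Carrier
  x ^ zero = 1#
  x ^ suc n = x * (x ^ n)

  detPow : GL2 → ℤ → Carrier
  detPow γ (+ n) = det γ ^ n
  detPow γ -[1+ n ] = inv (det γ) (GL2.det≢0 γ) ^ suc n

  -- (f|γ)(z) = (a+cz)^(-k) f((b+dz)/(a+cz))
  weight : ℤ → Poly → Poly → Poly → RatFun
  weight (+ n) w N D = N / (D *ₚ (w ^ₚ n))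
  weight -[1+ n ] w N D = (N *ₚ (w ^ₚ suc n)) / D

  slash : ℤ → GL2 → RatFun → RatFun
  slash k γ (g / h) =
    weight k w (homog g (length g) u w *ₚ (w ^ₚ length h))
               (homog h (length h) u w *ₚ (w ^ₚ length g))
    where
      u = lin (GL2.b γ) (GL2.d γ)
      w = lin (GL2.a γ) (GL2.c γ)

  -- Sym^t(St)[s]: homogeneous F(X,Y) = Σ_j α_j X^j Y^(t-j), stored as (α_0,…,α_t).
  -- Product of homogeneous forms = convolution of coefficient lists; the linear
  -- forms dX+bY and cX+aY are lin b d and lin a c.
  Sym : ℕ → Set
  Sym t = Vec Carrier (suc t)

  -- γ.F(X,Y) = det(γ)^s F(dX+bY, cX+aY)
  symAct : (t : ℕ) → ℤ → GL2 → Sym t → Sym t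
  symAct t s γ α = Vec.tabulate (λ j →
    coeff (detPow γ s ·ₚ homog (Vec.toList α) t
             (lin (GL2.b γ) (GL2.d γ)) (lin (GL2.a γ) (GL2.c γ))) (toℕ j))

  record RepIso (k : ℤ) (t : ℕ) (s m n : ℤ) : Set where
    field
      Φ : Sym t → RatFun
      Φ-into : ∀ α → InH0 m n (Φ α)
      Φ-+ : ∀ α β → Φ (Vec.zipWith _+_ α β) ≈ᵣ Φ α +ᵣ Φ β
      Φ-· : ∀ x α → Φ (Vec.map (x *_) α) ≈ᵣ x ·ᵣ Φ α
      Φ-inj : ∀ α β → Φ α ≈ᵣ Φ β → α ≡ β
      Φ-surj : ∀ f → InH0 m n f → Σ (Sym t) (λ α → Φ α ≈ᵣ f)
      Φ-equiv : ∀ γ α → Φ (symAct t s γ α) ≈ᵣ slash k γ (Φ α)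

{-# OPTIONS --safe #-}
-- Put m = h − i and n = k − m, so that the hypothesis on t reads t + n = m·q. Then
-- Φ(F) = F(z,1)/(z^q − z)^m identifies Sym^t with H⁰: since z^q − z = ∏_{b∈𝔽} (z − b) and no
-- irreducible of degree ≥ 2 divides it, the finite part of the divisor allows exactly the
-- denominators dividing (z^q − z)^m, and the condition at ∞ bounds the numerator's degree by
-- m·q − n = t. Equivariance reduces to the semi-invariance of z^q − z: for u = b + dz and
-- w = a + cz one has u^q = b + d z^q over 𝔽 (Fermat), hence u^q w − u w^q = det γ · (z^q − z).
module Submission where

open import Defs
open import Data.Nat as ℕ using (ℕ; zero; suc; _≤_; _<_; z≤n; s≤s; _∸_)
import Data.Nat.Properties as NP
open import Data.List using (List; []; _∷_; length)
import Data.List as List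
open import Data.Product using (Σ; _,_; _×_; proj₁; proj₂)
open import Data.Sum using (_⊎_; inj₁; inj₂)
open import Data.Empty using (⊥; ⊥-elim)
open import Relation.Binary.PropositionalEquality
open import Relation.Nullary using (yes; no; ¬_; Dec)
open import Function using (_∘_)
open import Algebra using (CommutativeRing)

module Convolution {q : ℕ} (𝔽 : FiniteField q) where

  import Algebra.Solver.Ring.NaturalCoefficients.Default

  open FiniteField 𝔽 public
  open FF 𝔽 public

  fieldRing : CommutativeRing _ _
  fieldRing = record { isCommutativeRing = isCommutativeRing }

  open CommutativeRing fieldRing public using
    (+-assoc; +-comm; *-assoc; *-comm; +-identityˡ; +-identityʳ; *-identityˡ; *-identityʳ;
     distribˡ; distribʳ; zeroˡ; zeroʳ; -‿inverseʳ; -‿inverseˡ)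

  module FS = Algebra.Solver.Ring.NaturalCoefficients.Default (CommutativeRing.commutativeSemiring fieldRing)
  open FS public using (_:+_; _:*_; _:=_)

  coeff-+ : ∀ p r j → coeff (p +ₚ r) j ≡ coeff p j + coeff r j
  coeff-+ [] r j = sym (+-identityˡ _)
  coeff-+ (a ∷ p) [] zero = sym (+-identityʳ a)
  coeff-+ (a ∷ p) [] (suc j) = sym (+-identityʳ _)
  coeff-+ (a ∷ p) (b ∷ r) zero = refl
  coeff-+ (a ∷ p) (b ∷ r) (suc j) = coeff-+ p r j

  coeff-· : ∀ c p j → coeff (c ·ₚ p) j ≡ c * coeff p j
  coeff-· c [] j = sym (zeroʳ c)
  coeff-· c (a ∷ p) zero = refl
  coeff-· c (a ∷ p) (suc j) = coeff-· c p j

  negₚ : Poly → Poly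
  negₚ = List.map -_

  -0≡0 : - 0# ≡ 0#
  -0≡0 = trans (sym (+-identityˡ _)) (-‿inverseʳ 0#)

  coeff-neg : ∀ p j → coeff (negₚ p) j ≡ - coeff p j
  coeff-neg [] j = sym -0≡0
  coeff-neg (a ∷ p) zero = refl
  coeff-neg (a ∷ p) (suc j) = coeff-neg p j

  conv : (ℕ → Carrier) → (ℕ → Carrier) → ℕ → Carrier
  conv f g zero = f 0 * g 0
  conv f g (suc j) = f 0 * g (suc j) + conv (f ∘ suc) g j

  conv-zeroˡ : ∀ f g → (∀ i → f i ≡ 0#) → ∀ j → conv f g j ≡ 0#
  conv-zeroˡ f g h zero rewrite h 0 = zeroˡ _
  conv-zeroˡ f g h (suc j) rewrite h 0 | conv-zeroˡ (f ∘ suc) g (h ∘ suc) j =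
    trans (cong (_+ 0#) (zeroˡ _)) (+-identityʳ _)

  conv-zeroʳ : ∀ f g → (∀ i → g i ≡ 0#) → ∀ j → conv f g j ≡ 0#
  conv-zeroʳ f g h zero rewrite h 0 = zeroʳ _
  conv-zeroʳ f g h (suc j) rewrite h (suc j) | conv-zeroʳ (f ∘ suc) g h j =
    trans (cong (_+ 0#) (zeroʳ _)) (+-identityʳ _)

  conv-cong : ∀ f f' g g' → (∀ i → f i ≡ f' i) → (∀ i → g i ≡ g' i) → ∀ j → conv f g j ≡ conv f' g' j
  conv-cong f f' g g' hf hom zero = cong₂ _*_ (hf 0) (hom 0)
  conv-cong f f' g g' hf hom (suc j) =
    cong₂ _+_ (cong₂ _*_ (hf 0) (hom (suc j))) (conv-cong (f ∘ suc) (f' ∘ suc) g g' (hf ∘ suc) hom j)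

  conv-+ˡ : ∀ f f' g j → conv (λ i → f i + f' i) g j ≡ conv f g j + conv f' g j
  conv-+ˡ f f' g zero = distribʳ _ _ _
  conv-+ˡ f f' g (suc j) rewrite conv-+ˡ (f ∘ suc) (f' ∘ suc) g j =
    FS.solve 5 (λ a b c x y → (((a :+ b) :* c) :+ (x :+ y)) := (((a :* c) :+ x) :+ ((b :* c) :+ y))) refl
      (f 0) (f' 0) (g (suc j)) (conv (f ∘ suc) g j) (conv (f' ∘ suc) g j)

  conv-+ʳ : ∀ f g g' j → conv f (λ i → g i + g' i) j ≡ conv f g j + conv f g' j
  conv-+ʳ f g g' zero = distribˡ _ _ _
  conv-+ʳ f g g' (suc j) rewrite conv-+ʳ (f ∘ suc) g g' j =
    FS.solve 5 (λ a b c x y → ((a :* (b :+ c)) :+ (x :+ y)) := (((a :* b) :+ x) :+ ((a :* c) :+ y))) refl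
      (f 0) (g (suc j)) (g' (suc j)) (conv (f ∘ suc) g j) (conv (f ∘ suc) g' j)

  conv-·ˡ : ∀ c f g j → conv (λ i → c * f i) g j ≡ c * conv f g j
  conv-·ˡ c f g zero = *-assoc _ _ _
  conv-·ˡ c f g (suc j) rewrite conv-·ˡ c (f ∘ suc) g j =
    FS.solve 4 (λ c a b x → (((c :* a) :* b) :+ (c :* x)) := (c :* ((a :* b) :+ x))) refl
      c (f 0) (g (suc j)) (conv (f ∘ suc) g j)

  conv-·ʳ : ∀ c f g j → conv f (λ i → c * g i) j ≡ c * conv f g j
  conv-·ʳ c f g zero = FS.solve 3 (λ c a b → (a :* (c :* b)) := (c :* (a :* b))) refl c (f 0) (g 0)
  conv-·ʳ c f g (suc j) rewrite conv-·ʳ c (f ∘ suc) g j =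
    FS.solve 4 (λ c a b x → ((a :* (c :* b)) :+ (c :* x)) := (c :* ((a :* b) :+ x))) refl
      c (f 0) (g (suc j)) (conv (f ∘ suc) g j)

  coeff-* : ∀ p r j → coeff (p *ₚ r) j ≡ conv (coeff p) (coeff r) j
  coeff-* [] r j = sym (conv-zeroˡ (coeff []) (coeff r) (λ _ → refl) j)
  coeff-* (a ∷ p) r zero =
    trans (coeff-+ (a ·ₚ r) (0# ∷ (p *ₚ r)) 0)
     (trans (cong (_+ 0#) (coeff-· a r 0)) (+-identityʳ _))
  coeff-* (a ∷ p) r (suc j) =
    trans (coeff-+ (a ·ₚ r) (0# ∷ (p *ₚ r)) (suc j))
     (cong₂ _+_ (coeff-· a r (suc j)) (coeff-* p r j))

module PolyRing {q : ℕ} (𝔽 : FiniteField q) where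

  open Convolution 𝔽 public
  open import Relation.Binary.Bundles using (Setoid)
  import Relation.Binary.Reasoning.Setoid
  import Algebra.Solver.Ring.NaturalCoefficients.Default

  infix 4 _≋_
  -- A record, unlike _≈ₚ_, keeps p and r visible to unification.
  record _≋_ (p r : Poly) : Set where
    constructor ⟨_⟩
    field at : ∀ j → coeff p j ≡ coeff r j
  open _≋_ public

  ≋-refl : ∀ {p} → p ≋ p
  ≋-refl = ⟨ (λ j → refl) ⟩
  ≋-sym : ∀ {p r} → p ≋ r → r ≋ p
  ≋-sym ⟨ h ⟩ = ⟨ (λ j → sym (h j)) ⟩
  ≋-trans : ∀ {p r s} → p ≋ r → r ≋ s → p ≋ s
  ≋-trans ⟨ h ⟩ ⟨ h' ⟩ = ⟨ (λ j → trans (h j) (h' j)) ⟩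

  ≡⇒≋ : ∀ {p r} → p ≡ r → p ≋ r
  ≡⇒≋ refl = ≋-refl

  ≋-Setoid : Setoid _ _
  ≋-Setoid = record { Carrier = Poly ; _≈_ = _≋_ ;
    isEquivalence = record { refl = ≋-refl ; sym = ≋-sym ; trans = ≋-trans } }

  module ≋R = Relation.Binary.Reasoning.Setoid ≋-Setoid

  1ₚ : Poly
  1ₚ = 1# ∷ []

  constₚ : Carrier → Poly
  constₚ x = x ∷ []

  infixl 6 _-ₚ_
  _-ₚ_ : Poly → Poly → Poly
  p -ₚ r = p +ₚ negₚ r

  +-cong : ∀ {p p' r r'} → p ≋ p' → r ≋ r' → p +ₚ r ≋ p' +ₚ r'
  +-cong {p} {p'} {r} {r'} ⟨ h ⟩ ⟨ h' ⟩ = ⟨ (λ j → trans (coeff-+ p r j) (trans (cong₂ _+_ (h j) (h' j)) (sym (coeff-+ p' r' j)))) ⟩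

  ·-cong : ∀ {c c' p p'} → c ≡ c' → p ≋ p' → c ·ₚ p ≋ c' ·ₚ p'
  ·-cong {c} {c'} {p} {p'} e ⟨ h ⟩ = ⟨ (λ j → trans (coeff-· c p j) (trans (cong₂ _*_ e (h j)) (sym (coeff-· c' p' j)))) ⟩

  neg-cong : ∀ {p p'} → p ≋ p' → negₚ p ≋ negₚ p'
  neg-cong {p} {p'} ⟨ h ⟩ = ⟨ (λ j → trans (coeff-neg p j) (trans (cong -_ (h j)) (sym (coeff-neg p' j)))) ⟩

  *-cong : ∀ {p p' r r'} → p ≋ p' → r ≋ r' → p *ₚ r ≋ p' *ₚ r'
  *-cong {p} {p'} {r} {r'} ⟨ h ⟩ ⟨ h' ⟩ = ⟨ (λ j → trans (coeff-* p r j) (trans (conv-cong _ _ _ _ h h' j) (sym (coeff-* p' r' j)))) ⟩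

  ∷-cong : ∀ {a b p r} → a ≡ b → p ≋ r → (a ∷ p) ≋ (b ∷ r)
  ∷-cong e ⟨ h ⟩ = ⟨ (λ { zero → e ; (suc j) → h j }) ⟩

  +ₚ-comm : ∀ p r → p +ₚ r ≋ r +ₚ p
  +ₚ-comm p r = ⟨ (λ j → trans (coeff-+ p r j) (trans (+-comm _ _) (sym (coeff-+ r p j)))) ⟩

  +ₚ-assoc : ∀ p r s → (p +ₚ r) +ₚ s ≋ p +ₚ (r +ₚ s)
  +ₚ-assoc p r s = ⟨ (λ j → trans (coeff-+ (p +ₚ r) s j) (trans (cong (_+ coeff s j) (coeff-+ p r j))
     (trans (+-assoc _ _ _) (sym (trans (coeff-+ p (r +ₚ s) j) (cong (coeff p j +_) (coeff-+ r s j))))))) ⟩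

  +ₚ-identityˡ : ∀ p → [] +ₚ p ≋ p
  +ₚ-identityˡ p = ≋-refl

  +ₚ-identityʳ : ∀ p → p +ₚ [] ≋ p
  +ₚ-identityʳ p = ⟨ (λ j → trans (coeff-+ p [] j) (+-identityʳ _)) ⟩

  +ₚ-inverseʳ : ∀ p → p +ₚ negₚ p ≋ []
  +ₚ-inverseʳ p = ⟨ (λ j → trans (coeff-+ p (negₚ p) j) (trans (cong (coeff p j +_) (coeff-neg p j)) (-‿inverseʳ _))) ⟩

  +ₚ-inverseˡ : ∀ p → negₚ p +ₚ p ≋ []
  +ₚ-inverseˡ p = ≋-trans (+ₚ-comm _ p) (+ₚ-inverseʳ p)

  *-distribʳ : ∀ p p' r → (p +ₚ p') *ₚ r ≋ p *ₚ r +ₚ p' *ₚ r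
  *-distribʳ p p' r = ⟨ (λ j → begin
    coeff ((p +ₚ p') *ₚ r) j ≡⟨ coeff-* (p +ₚ p') r j ⟩
    conv (coeff (p +ₚ p')) (coeff r) j ≡⟨ conv-cong (coeff (p +ₚ p')) (λ i → coeff p i + coeff p' i) (coeff r) (coeff r) (coeff-+ p p') (λ _ → refl) j ⟩
    conv (λ i → coeff p i + coeff p' i) (coeff r) j ≡⟨ conv-+ˡ (coeff p) (coeff p') (coeff r) j ⟩
    conv (coeff p) (coeff r) j + conv (coeff p') (coeff r) j ≡⟨ cong₂ _+_ (sym (coeff-* p r j)) (sym (coeff-* p' r j)) ⟩
    coeff (p *ₚ r) j + coeff (p' *ₚ r) j ≡⟨ sym (coeff-+ (p *ₚ r) (p' *ₚ r) j) ⟩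
    coeff (p *ₚ r +ₚ p' *ₚ r) j ∎) ⟩
    where open ≡-Reasoning

  *-distribˡ' : ∀ p r r' → p *ₚ (r +ₚ r') ≋ p *ₚ r +ₚ p *ₚ r'
  *-distribˡ' p r r' = ⟨ (λ j → begin
    coeff (p *ₚ (r +ₚ r')) j ≡⟨ coeff-* p (r +ₚ r') j ⟩
    conv (coeff p) (coeff (r +ₚ r')) j ≡⟨ conv-cong (coeff p) (coeff p) (coeff (r +ₚ r')) (λ i → coeff r i + coeff r' i) (λ _ → refl) (coeff-+ r r') j ⟩
    conv (coeff p) (λ i → coeff r i + coeff r' i) j ≡⟨ conv-+ʳ (coeff p) (coeff r) (coeff r') j ⟩
    conv (coeff p) (coeff r) j + conv (coeff p) (coeff r') j ≡⟨ cong₂ _+_ (sym (coeff-* p r j)) (sym (coeff-* p r' j)) ⟩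
    coeff (p *ₚ r) j + coeff (p *ₚ r') j ≡⟨ sym (coeff-+ (p *ₚ r) (p *ₚ r') j) ⟩
    coeff (p *ₚ r +ₚ p *ₚ r') j ∎) ⟩
    where open ≡-Reasoning

  ·-*ˡ : ∀ c p r → (c ·ₚ p) *ₚ r ≋ c ·ₚ (p *ₚ r)
  ·-*ˡ c p r = ⟨ (λ j → begin
    coeff ((c ·ₚ p) *ₚ r) j ≡⟨ coeff-* (c ·ₚ p) r j ⟩
    conv (coeff (c ·ₚ p)) (coeff r) j ≡⟨ conv-cong (coeff (c ·ₚ p)) (λ i → c * coeff p i) (coeff r) (coeff r) (coeff-· c p) (λ _ → refl) j ⟩
    conv (λ i → c * coeff p i) (coeff r) j ≡⟨ conv-·ˡ c (coeff p) (coeff r) j ⟩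
    c * conv (coeff p) (coeff r) j ≡⟨ cong (c *_) (sym (coeff-* p r j)) ⟩
    c * coeff (p *ₚ r) j ≡⟨ sym (coeff-· c (p *ₚ r) j) ⟩
    coeff (c ·ₚ (p *ₚ r)) j ∎) ⟩
    where open ≡-Reasoning

  ·-*ʳ : ∀ c p r → p *ₚ (c ·ₚ r) ≋ c ·ₚ (p *ₚ r)
  ·-*ʳ c p r = ⟨ (λ j → begin
    coeff (p *ₚ (c ·ₚ r)) j ≡⟨ coeff-* p (c ·ₚ r) j ⟩
    conv (coeff p) (coeff (c ·ₚ r)) j ≡⟨ conv-cong (coeff p) (coeff p) (coeff (c ·ₚ r)) (λ i → c * coeff r i) (λ _ → refl) (coeff-· c r) j ⟩
    conv (coeff p) (λ i → c * coeff r i) j ≡⟨ conv-·ʳ c (coeff p) (coeff r) j ⟩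
    c * conv (coeff p) (coeff r) j ≡⟨ cong (c *_) (sym (coeff-* p r j)) ⟩
    c * coeff (p *ₚ r) j ≡⟨ sym (coeff-· c (p *ₚ r) j) ⟩
    coeff (c ·ₚ (p *ₚ r)) j ∎) ⟩
    where open ≡-Reasoning

  *-zeroʳ : ∀ p → p *ₚ [] ≋ []
  *-zeroʳ p = ⟨ (λ j → trans (coeff-* p [] j) (conv-zeroʳ (coeff p) (coeff []) (λ _ → refl) j)) ⟩

  0·≋ : ∀ p → 0# ·ₚ p ≋ []
  0·≋ p = ⟨ (λ j → trans (coeff-· 0# p j) (zeroˡ _)) ⟩

  0∷-* : ∀ p r → (0# ∷ p) *ₚ r ≋ 0# ∷ (p *ₚ r)
  0∷-* p r = ≋-trans (+-cong (0·≋ r) ≋-refl) ≋-refl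

  *-consʳ : ∀ r a p → r *ₚ (a ∷ p) ≋ a ·ₚ r +ₚ (0# ∷ (r *ₚ p))
  *-consʳ [] a p = ⟨ (λ { zero → refl ; (suc j) → refl }) ⟩
  *-consʳ (b ∷ r) a p = ⟨ (λ
    { zero → trans (cong (_+ 0#) (*-comm b a)) (sym (coeff-+ (a ·ₚ (b ∷ r)) (0# ∷ ((b ∷ r) *ₚ p)) 0))
    ; (suc j) → begin
        coeff (b ·ₚ p +ₚ r *ₚ (a ∷ p)) j ≡⟨ coeff-+ (b ·ₚ p) (r *ₚ (a ∷ p)) j ⟩
        coeff (b ·ₚ p) j + coeff (r *ₚ (a ∷ p)) j ≡⟨ cong (coeff (b ·ₚ p) j +_) (at (*-consʳ r a p) j) ⟩
        coeff (b ·ₚ p) j + coeff (a ·ₚ r +ₚ (0# ∷ (r *ₚ p))) j ≡⟨ cong (coeff (b ·ₚ p) j +_) (coeff-+ (a ·ₚ r) (0# ∷ (r *ₚ p)) j) ⟩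
        coeff (b ·ₚ p) j + (coeff (a ·ₚ r) j + coeff (0# ∷ (r *ₚ p)) j)
          ≡⟨ FS.solve 3 (λ x y z → (x :+ (y :+ z)) := (y :+ (x :+ z))) refl _ _ _ ⟩
        coeff (a ·ₚ r) j + (coeff (b ·ₚ p) j + coeff (0# ∷ (r *ₚ p)) j)
          ≡⟨ sym (cong (coeff (a ·ₚ r) j +_) (coeff-+ (b ·ₚ p) (0# ∷ (r *ₚ p)) j)) ⟩
        coeff (a ·ₚ r) j + coeff (b ·ₚ p +ₚ (0# ∷ (r *ₚ p))) j ≡⟨ sym (coeff-+ (a ·ₚ r) (b ·ₚ p +ₚ (0# ∷ (r *ₚ p))) j) ⟩
        coeff (a ·ₚ r +ₚ (b ·ₚ p +ₚ (0# ∷ (r *ₚ p)))) j ∎ }) ⟩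
    where open ≡-Reasoning

  *ₚ-comm : ∀ p r → p *ₚ r ≋ r *ₚ p
  *ₚ-comm [] r = ≋-sym (*-zeroʳ r)
  *ₚ-comm (a ∷ p) r = ≋-trans (+-cong ≋-refl (∷-cong refl (*ₚ-comm p r))) (≋-sym (*-consʳ r a p))

  *ₚ-assoc : ∀ p r s → (p *ₚ r) *ₚ s ≋ p *ₚ (r *ₚ s)
  *ₚ-assoc [] r s = ≋-refl
  *ₚ-assoc (a ∷ p) r s = begin
    (a ·ₚ r +ₚ (0# ∷ (p *ₚ r))) *ₚ s ≈⟨ *-distribʳ (a ·ₚ r) (0# ∷ (p *ₚ r)) s ⟩
    (a ·ₚ r) *ₚ s +ₚ (0# ∷ (p *ₚ r)) *ₚ s ≈⟨ +-cong (·-*ˡ a r s) (0∷-* (p *ₚ r) s) ⟩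
    a ·ₚ (r *ₚ s) +ₚ (0# ∷ ((p *ₚ r) *ₚ s)) ≈⟨ +-cong ≋-refl (∷-cong refl (*ₚ-assoc p r s)) ⟩
    a ·ₚ (r *ₚ s) +ₚ (0# ∷ (p *ₚ (r *ₚ s))) ∎
    where open ≋R

  1·≋ : ∀ p → 1# ·ₚ p ≋ p
  1·≋ p = ⟨ (λ j → trans (coeff-· 1# p j) (*-identityˡ _)) ⟩

  *-identityˡₚ : ∀ p → 1ₚ *ₚ p ≋ p
  *-identityˡₚ p = ≋-trans (+-cong (1·≋ p) (≋-trans (∷-cong refl ≋-refl) ⟨ (λ { zero → refl ; (suc j) → refl }) ⟩)) (+ₚ-identityʳ p)

  *-identityʳₚ : ∀ p → p *ₚ 1ₚ ≋ p
  *-identityʳₚ p = ≋-trans (*ₚ-comm p 1ₚ) (*-identityˡₚ p)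

  *-distribˡ : ∀ p r r' → p *ₚ (r +ₚ r') ≋ p *ₚ r +ₚ p *ₚ r'
  *-distribˡ = *-distribˡ'

  polyRing : CommutativeRing _ _
  polyRing = record
    { Carrier = Poly ; _≈_ = _≋_ ; _+_ = _+ₚ_ ; _*_ = _*ₚ_ ; -_ = negₚ ; 0# = [] ; 1# = 1ₚ
    ; isCommutativeRing = record
      { isRing = record
        { +-isAbelianGroup = record
          { isGroup = record
            { isMonoid = record
              { isSemigroup = record
                { isMagma = record { isEquivalence = Setoid.isEquivalence ≋-Setoid ; ∙-cong = +-cong }
                ; assoc = +ₚ-assoc }
              ; identity = +ₚ-identityˡ , +ₚ-identityʳ }
            ; inverse = +ₚ-inverseˡ , +ₚ-inverseʳ
            ; ⁻¹-cong = neg-cong }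
          ; comm = +ₚ-comm }
        ; *-cong = *-cong
        ; *-assoc = *ₚ-assoc
        ; *-identity = *-identityˡₚ , *-identityʳₚ
        ; distrib = *-distribˡ , (λ r p p' → *-distribʳ p p' r) }
      ; *-comm = *ₚ-comm } }

  module PS = Algebra.Solver.Ring.NaturalCoefficients.Default (CommutativeRing.commutativeSemiring polyRing)

  infixl 6 _⊞_
  infixl 7 _⊠_
  infix 4 _≐_
  _⊞_ : ∀ {n} → PS.Polynomial n → PS.Polynomial n → PS.Polynomial n
  _⊞_ = PS._:+_
  _⊠_ : ∀ {n} → PS.Polynomial n → PS.Polynomial n → PS.Polynomial n
  _⊠_ = PS._:*_
  _≐_ : ∀ {n} → PS.Polynomial n → PS.Polynomial n → _
  _≐_ = PS._:=_

  *-congˡ : ∀ p {r r'} → r ≋ r' → p *ₚ r ≋ p *ₚ r'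
  *-congˡ p h = *-cong (≋-refl {p}) h
  *-congʳ : ∀ {p p'} r → p ≋ p' → p *ₚ r ≋ p' *ₚ r
  *-congʳ r h = *-cong h (≋-refl {r})
  +-congˡ : ∀ p {r r'} → r ≋ r' → p +ₚ r ≋ p +ₚ r'
  +-congˡ p h = +-cong (≋-refl {p}) h
  +-congʳ : ∀ {p p'} r → p ≋ p' → p +ₚ r ≋ p' +ₚ r
  +-congʳ r h = +-cong h (≋-refl {r})

module Degree {q : ℕ} (𝔽 : FiniteField q) where

  open PolyRing 𝔽 public
  open import Relation.Binary.Definitions using (tri<; tri≈; tri>)
  import Algebra.Properties.Ring
  import Algebra.Properties.Group
  import Algebra.Properties.AbelianGroup

  module FRP = Algebra.Properties.Ring (CommutativeRing.ring fieldRing)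
  module FAG = Algebra.Properties.AbelianGroup (CommutativeRing.+-abelianGroup fieldRing)
  module FGP = Algebra.Properties.Group (CommutativeRing.+-group fieldRing)
  module PRP = Algebra.Properties.Ring (CommutativeRing.ring polyRing)
  module PGP = Algebra.Properties.Group (CommutativeRing.+-group polyRing)

  Nonzero : Poly → Set
  Nonzero p = ¬ (p ≋ [])

  inv-l : ∀ x (h : ¬ x ≡ 0#) → inv x h * x ≡ 1#
  inv-l x h = trans (*-comm _ _) (inv-correct x h)

  *-nonzero : ∀ {x y} → ¬ x ≡ 0# → ¬ y ≡ 0# → ¬ (x * y ≡ 0#)
  *-nonzero {x} {y} hx hy e = hy (begin
    y ≡⟨ sym (*-identityˡ y) ⟩
    1# * y ≡⟨ cong (_* y) (sym (inv-l x hx)) ⟩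
    (inv x hx * x) * y ≡⟨ *-assoc _ _ _ ⟩
    inv x hx * (x * y) ≡⟨ cong (inv x hx *_) e ⟩
    inv x hx * 0# ≡⟨ zeroʳ _ ⟩
    0# ∎)
    where open ≡-Reasoning

  1≢0 : ¬ (1# ≡ 0#)
  1≢0 e = 0≢1 (sym e)

  sub0⇒≡ : ∀ x y → x + - y ≡ 0# → x ≡ y
  sub0⇒≡ x y e = begin
    x ≡⟨ sym (+-identityʳ x) ⟩
    x + 0# ≡⟨ cong (x +_) (sym (-‿inverseˡ y)) ⟩
    x + (- y + y) ≡⟨ sym (+-assoc _ _ _) ⟩
    (x + - y) + y ≡⟨ cong (_+ y) e ⟩
    0# + y ≡⟨ +-identityˡ y ⟩
    y ∎
    where open ≡-Reasoning

  coeff-len : ∀ p j → length p ≤ j → coeff p j ≡ 0#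
  coeff-len [] j _ = refl
  coeff-len (a ∷ p) (suc j) (s≤s h) = coeff-len p j h

  degView : ∀ p → p ≋ [] ⊎ Σ ℕ (HasDeg p)
  degView [] = inj₁ ≋-refl
  degView (a ∷ p) with degView p
  ... | inj₂ (n , nz , hi) = inj₂ (suc n , nz , λ { zero () ; (suc j) (s≤s lt) → hi j lt })
  ... | inj₁ h with a ≟ 0#
  ...   | yes e = inj₁ ⟨ (λ { zero → e ; (suc j) → at h j }) ⟩
  ...   | no ne = inj₂ (0 , ne , λ { zero () ; (suc j) _ → at h j })

  HasDeg-cong : ∀ {p r n} → p ≋ r → HasDeg p n → HasDeg r n
  HasDeg-cong {n = n} ⟨ h ⟩ (nz , hi) = (λ e → nz (trans (h n) e)) , λ j lt → trans (sym (h j)) (hi j lt)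

  HasDeg⇒nonzero : ∀ {p n} → HasDeg p n → Nonzero p
  HasDeg⇒nonzero {n = n} (nz , _) ⟨ h ⟩ = nz (h n)

  deg-unique : ∀ {p n m} → HasDeg p n → HasDeg p m → n ≡ m
  deg-unique {p} {n} {m} (nz , hi) (nz' , hi') with NP.<-cmp n m
  ... | tri< a _ _ = ⊥-elim (nz' (hi m a))
  ... | tri≈ _ b _ = b
  ... | tri> _ _ c = ⊥-elim (nz (hi' n c))

  HasDeg≤length : ∀ {p d} → HasDeg p d → d ≤ length p
  HasDeg≤length {p} {d} (lc≢0 , _) with d NP.≤? length p
  ... | yes d≤len = d≤len
  ... | no d≰len = ⊥-elim (lc≢0 (coeff-len p d (NP.<⇒≤ (NP.≰⇒> d≰len))))

  DegLt : Poly → ℕ → Set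
  DegLt p n = ∀ j → n ≤ j → coeff p j ≡ 0#

  conv-hi : ∀ n m f g → (∀ j → n < j → f j ≡ 0#) → (∀ j → m < j → g j ≡ 0#) →
          ∀ j → n ℕ.+ m < j → conv f g j ≡ 0#
  conv-hi zero m f g hf hom (suc j) (s≤s lt) =
    trans (cong₂ _+_ (trans (cong (f 0 *_) (hom (suc j) (s≤s lt))) (zeroʳ _))
                     (conv-zeroˡ (f ∘ suc) g (λ i → hf (suc i) (s≤s z≤n)) j)) (+-identityʳ _)
  conv-hi (suc n) m f g hf hom (suc j) (s≤s lt) =
    trans (cong₂ _+_ (trans (cong (f 0 *_) (hom (suc j) (s≤s (NP.≤-trans (NP.m≤n+m m n) (NP.<⇒≤ lt))))) (zeroʳ _))
                     (conv-hi n m (f ∘ suc) g (λ i h → hf (suc i) (s≤s h)) hom j lt)) (+-identityˡ _)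

  conv-top : ∀ n m f g → (∀ j → n < j → f j ≡ 0#) → (∀ j → m < j → g j ≡ 0#) →
           conv f g (n ℕ.+ m) ≡ f n * g m
  conv-top zero zero f g hf hom = refl
  conv-top zero (suc m) f g hf hom =
    trans (cong (f 0 * g (suc m) +_) (conv-zeroˡ (f ∘ suc) g (λ i → hf (suc i) (s≤s z≤n)) m)) (+-identityʳ _)
  conv-top (suc n) m f g hf hom =
    trans (cong₂ _+_ (trans (cong (f 0 *_) (hom (suc (n ℕ.+ m)) (s≤s (NP.m≤n+m m n)))) (zeroʳ _))
                     (conv-top n m (f ∘ suc) g (λ i h → hf (suc i) (s≤s h)) hom)) (+-identityˡ _)

  lc-* : ∀ {p r n m} → HasDeg p n → HasDeg r m → coeff (p *ₚ r) (n ℕ.+ m) ≡ coeff p n * coeff r m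
  lc-* {p} {r} {n} {m} (_ , hp) (_ , hr) = trans (coeff-* p r (n ℕ.+ m)) (conv-top n m (coeff p) (coeff r) hp hr)

  HasDeg-* : ∀ {p r n m} → HasDeg p n → HasDeg r m → HasDeg (p *ₚ r) (n ℕ.+ m)
  HasDeg-* {p} {r} {n} {m} dp@(np , hp) dr@(nr , hr) =
    (λ e → *-nonzero np nr (trans (sym (lc-* {p} {r} dp dr)) e)) ,
    λ j lt → trans (coeff-* p r j) (conv-hi n m (coeff p) (coeff r) hp hr j lt)

  nonzero-* : ∀ {p r} → Nonzero p → Nonzero r → Nonzero (p *ₚ r)
  nonzero-* {p} {r} hp hr with degView p | degView r
  ... | inj₁ e | _ = ⊥-elim (hp e)
  ... | _ | inj₁ e = ⊥-elim (hr e)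
  ... | inj₂ (n , dp) | inj₂ (m , dr) = HasDeg⇒nonzero {p *ₚ r} (HasDeg-* {p} {r} dp dr)

  neg-*ʳ : ∀ p r → p *ₚ negₚ r ≋ negₚ (p *ₚ r)
  neg-*ʳ p r = ≋-sym (PRP.-‿distribʳ-* p r)

  cancelˡ : ∀ {p a b} → Nonzero p → p *ₚ a ≋ p *ₚ b → a ≋ b
  cancelˡ {p} {a} {b} hp e = PGP.x∙y⁻¹≈ε⇒x≈y a b (dec (degView (a -ₚ b)))
    where
    h0 : p *ₚ (a -ₚ b) ≋ []
    h0 = ≋-trans (PRP.x[y-z]≈xy-xz p a b) (PGP.x≈y⇒x∙y⁻¹≈ε e)
    dec : (a -ₚ b) ≋ [] ⊎ Σ ℕ (HasDeg (a -ₚ b)) → (a -ₚ b) ≋ []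
    dec (inj₁ x) = x
    dec (inj₂ (n , d)) = ⊥-elim (nonzero-* hp (HasDeg⇒nonzero d) h0)

  cancelʳ : ∀ {p a b} → Nonzero p → a *ₚ p ≋ b *ₚ p → a ≋ b
  cancelʳ {p} {a} {b} hp e = cancelˡ hp (≋-trans (*ₚ-comm p a) (≋-trans e (*ₚ-comm b p)))

  ^-cong : ∀ {p r} n → p ≋ r → p ^ₚ n ≋ r ^ₚ n
  ^-cong zero h = ≋-refl
  ^-cong (suc n) h = *-cong h (^-cong n h)

  pow-+ : ∀ p a b → p ^ₚ (a ℕ.+ b) ≋ p ^ₚ a *ₚ p ^ₚ b
  pow-+ p zero b = ≋-sym (*-identityˡₚ (p ^ₚ b))
  pow-+ p (suc a) b = ≋-trans (*-congˡ p (pow-+ p a b)) (≋-sym (*ₚ-assoc p (p ^ₚ a) (p ^ₚ b)))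

  pow-* : ∀ p r n → (p *ₚ r) ^ₚ n ≋ p ^ₚ n *ₚ r ^ₚ n
  pow-* p r zero = ≋-sym (*-identityˡₚ 1ₚ)
  pow-* p r (suc n) = ≋-trans (*-congˡ (p *ₚ r) (pow-* p r n))
    (PS.solve 4 (λ p r a b → (p ⊠ r) ⊠ (a ⊠ b) ≐ (p ⊠ a) ⊠ (r ⊠ b)) ≋-refl p r (p ^ₚ n) (r ^ₚ n))

  HasDeg-^ : ∀ {p d} n → HasDeg p d → HasDeg (p ^ₚ n) (n ℕ.* d) × coeff (p ^ₚ n) (n ℕ.* d) ≡ coeff p d ^ n
  HasDeg-^ zero hd = ((λ e → 1≢0 e) , λ { zero () ; (suc j) _ → refl }) , refl
  HasDeg-^ {p} {d} (suc n) hd =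
    HasDeg-* {p} {p ^ₚ n} hd (proj₁ (HasDeg-^ {p} {d} n hd)) ,
    trans (lc-* {p} {p ^ₚ n} hd (proj₁ (HasDeg-^ {p} {d} n hd))) (cong (coeff p d *_) (proj₂ (HasDeg-^ {p} {d} n hd)))

  DegLe : Poly → ℕ → Set
  DegLe p n = ∀ j → n < j → coeff p j ≡ 0#

  DegLe-* : ∀ p r n m → DegLe p n → DegLe r m → DegLe (p *ₚ r) (n ℕ.+ m)
  DegLe-* p r n m hp hr j lt = trans (coeff-* p r j) (conv-hi n m (coeff p) (coeff r) hp hr j lt)

  top-* : ∀ p r n m → DegLe p n → DegLe r m → coeff (p *ₚ r) (n ℕ.+ m) ≡ coeff p n * coeff r m
  top-* p r n m hp hr = trans (coeff-* p r (n ℕ.+ m)) (conv-top n m (coeff p) (coeff r) hp hr)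

  DegLe-^ : ∀ p n → DegLe p n → ∀ k → DegLe (p ^ₚ k) (k ℕ.* n) × coeff (p ^ₚ k) (k ℕ.* n) ≡ coeff p n ^ k
  DegLe-^ p n h zero = (λ { zero () ; (suc j) _ → refl }) , refl
  DegLe-^ p n h (suc k) = DegLe-* p (p ^ₚ k) n (k ℕ.* n) h (proj₁ (DegLe-^ p n h k)) ,
    trans (top-* p (p ^ₚ k) n (k ℕ.* n) h (proj₁ (DegLe-^ p n h k))) (cong (coeff p n *_) (proj₂ (DegLe-^ p n h k)))

  DegLe-lin : ∀ b d → DegLe (lin b d) 1
  DegLe-lin b d (suc zero) (s≤s ())
  DegLe-lin b d (suc (suc j)) _ = refl

  nonzero-^ : ∀ {p} n → Nonzero p → Nonzero (p ^ₚ n)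
  nonzero-^ zero hp ⟨ h ⟩ = 1≢0 (h 0)
  nonzero-^ (suc n) hp = nonzero-* hp (nonzero-^ n hp)

  ev : Poly → Carrier → Carrier
  ev [] x = 0#
  ev (a ∷ p) x = a + x * ev p x

  ev-0 : ∀ p x → p ≋ [] → ev p x ≡ 0#
  ev-0 [] x h = refl
  ev-0 (a ∷ p) x ⟨ h ⟩ = trans (cong₂ (λ u v → u + x * v) (h 0) (ev-0 p x ⟨ (h ∘ suc) ⟩))
    (trans (+-identityˡ _) (zeroʳ x))

  ev-cong : ∀ p r x → p ≋ r → ev p x ≡ ev r x
  ev-cong [] r x h = sym (ev-0 r x (≋-sym h))
  ev-cong (a ∷ p) [] x h = ev-0 (a ∷ p) x h
  ev-cong (a ∷ p) (b ∷ r) x ⟨ h ⟩ = cong₂ (λ u v → u + x * v) (h 0) (ev-cong p r x ⟨ (h ∘ suc) ⟩)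

  ev-+ : ∀ p r x → ev (p +ₚ r) x ≡ ev p x + ev r x
  ev-+ [] r x = sym (+-identityˡ _)
  ev-+ (a ∷ p) [] x = sym (+-identityʳ _)
  ev-+ (a ∷ p) (b ∷ r) x rewrite ev-+ p r x =
    FS.solve 5 (λ a b x u v → ((a :+ b) :+ (x :* (u :+ v))) := ((a :+ (x :* u)) :+ (b :+ (x :* v)))) refl a b x (ev p x) (ev r x)

  ev-· : ∀ c p x → ev (c ·ₚ p) x ≡ c * ev p x
  ev-· c [] x = sym (zeroʳ c)
  ev-· c (a ∷ p) x rewrite ev-· c p x =
    FS.solve 4 (λ c a x u → ((c :* a) :+ (x :* (c :* u))) := (c :* (a :+ (x :* u)))) refl c a x (ev p x)

  ev-* : ∀ p r x → ev (p *ₚ r) x ≡ ev p x * ev r x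
  ev-* [] r x = sym (zeroˡ _)
  ev-* (a ∷ p) r x = begin
    ev (a ·ₚ r +ₚ (0# ∷ (p *ₚ r))) x ≡⟨ ev-+ (a ·ₚ r) (0# ∷ (p *ₚ r)) x ⟩
    ev (a ·ₚ r) x + (0# + x * ev (p *ₚ r) x) ≡⟨ cong₂ (λ u v → u + (0# + x * v)) (ev-· a r x) (ev-* p r x) ⟩
    a * ev r x + (0# + x * (ev p x * ev r x)) ≡⟨ cong (a * ev r x +_) (+-identityˡ _) ⟩
    a * ev r x + x * (ev p x * ev r x) ≡⟨ FS.solve 4 (λ a x u v → ((a :* v) :+ (x :* (u :* v))) := ((a :+ (x :* u)) :* v)) refl a x (ev p x) (ev r x) ⟩
    (a + x * ev p x) * ev r x ∎
    where open ≡-Reasoning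

  ev-^ : ∀ p n x → ev (p ^ₚ n) x ≡ ev p x ^ n
  ev-^ p zero x = trans (cong (1# +_) (zeroʳ x)) (+-identityʳ _)
  ev-^ p (suc n) x = trans (ev-* p (p ^ₚ n) x) (cong (ev p x *_) (ev-^ p n x))

  ev-neg : ∀ p x → ev (negₚ p) x ≡ - ev p x
  ev-neg [] x = sym -0≡0
  ev-neg (a ∷ p) x = trans (cong (λ v → - a + x * v) (ev-neg p x))
    (trans (cong (- a +_) (sym (FRP.-‿distribʳ-* x (ev p x)))) (FAG.⁻¹-∙-comm a (x * ev p x)))

  ^-nonzero : ∀ {x} n → ¬ x ≡ 0# → ¬ (x ^ n ≡ 0#)
  ^-nonzero zero h = 1≢0
  ^-nonzero (suc n) h = *-nonzero h (^-nonzero n h)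

  z-minus : Carrier → Poly
  z-minus b = lin (- b) 1#

  factor : ∀ P b → Σ Poly (λ Q → P ≋ z-minus b *ₚ Q +ₚ (ev P b ∷ []))
  factor [] b = [] , ⟨ (λ j → sym (trans (coeff-+ (z-minus b *ₚ []) (0# ∷ []) j)
     (trans (cong₂ _+_ (at (*-zeroʳ (z-minus b)) j) (lem j)) (+-identityˡ _)))) ⟩
    where lem : ∀ j → coeff (0# ∷ []) j ≡ 0#
          lem zero = refl
          lem (suc j) = refl
  factor (a ∷ p) b with factor p b
  ... | Q' , h = (ev p b ∷ Q') , ⟨ lem ⟩
    where
    e : Carrier
    e = ev p b
    L : Poly
    L = z-minus b
    lem : ∀ j → coeff (a ∷ p) j ≡ coeff (L *ₚ (e ∷ Q') +ₚ (ev (a ∷ p) b ∷ [])) j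
    lem j = sym (begin
      coeff (L *ₚ (e ∷ Q') +ₚ (ev (a ∷ p) b ∷ [])) j ≡⟨ coeff-+ (L *ₚ (e ∷ Q')) (ev (a ∷ p) b ∷ []) j ⟩
      coeff (L *ₚ (e ∷ Q')) j + coeff (ev (a ∷ p) b ∷ []) j ≡⟨ cong (_+ coeff (ev (a ∷ p) b ∷ []) j) (at (*-consʳ L e Q') j) ⟩
      coeff (e ·ₚ L +ₚ (0# ∷ (L *ₚ Q'))) j + coeff (ev (a ∷ p) b ∷ []) j ≡⟨ cong (_+ coeff (ev (a ∷ p) b ∷ []) j) (coeff-+ (e ·ₚ L) (0# ∷ (L *ₚ Q')) j) ⟩
      (coeff (e ·ₚ L) j + coeff (0# ∷ (L *ₚ Q')) j) + coeff (ev (a ∷ p) b ∷ []) j ≡⟨ fin j ⟩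
      coeff (a ∷ p) j ∎)
      where
      open ≡-Reasoning
      fin : ∀ j → (coeff (e ·ₚ L) j + coeff (0# ∷ (L *ₚ Q')) j) + coeff (ev (a ∷ p) b ∷ []) j ≡ coeff (a ∷ p) j
      fin zero = begin
        (e * - b + 0#) + (a + b * e) ≡⟨ cong₂ (λ u v → u + (a + v)) (trans (+-identityʳ _) (sym (FRP.-‿distribʳ-* e b))) (*-comm b e) ⟩
        - (e * b) + (a + e * b) ≡⟨ FS.solve 3 (λ n a u → (n :+ (a :+ u)) := (a :+ (n :+ u))) refl (- (e * b)) a (e * b) ⟩
        a + (- (e * b) + e * b) ≡⟨ cong (a +_) (-‿inverseˡ _) ⟩
        a + 0# ≡⟨ +-identityʳ a ⟩
        a ∎
      fin (suc zero) = begin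
        (e * 1# + coeff (L *ₚ Q') 0) + 0# ≡⟨ trans (+-identityʳ _) (trans (cong (_+ coeff (L *ₚ Q') 0) (*-identityʳ e)) (+-comm _ _)) ⟩
        coeff (L *ₚ Q') 0 + e ≡⟨ sym (trans (at h 0) (coeff-+ (L *ₚ Q') (e ∷ []) 0)) ⟩
        coeff p 0 ∎
      fin (suc (suc j)) = begin
        (0# + coeff (L *ₚ Q') (suc j)) + 0# ≡⟨ trans (+-identityʳ _) (trans (+-identityˡ _) (sym (+-identityʳ _))) ⟩
        coeff (L *ₚ Q') (suc j) + 0# ≡⟨ sym (trans (at h (suc j)) (coeff-+ (L *ₚ Q') (e ∷ []) (suc j))) ⟩
        coeff p (suc j) ∎

module Division {q : ℕ} (𝔽 : FiniteField q) where

  open Degree 𝔽 public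

  shift : ℕ → Poly → Poly
  shift zero p = p
  shift (suc k) p = 0# ∷ shift k p

  coeff-shift-hi : ∀ k p i → coeff (shift k p) (k ℕ.+ i) ≡ coeff p i
  coeff-shift-hi zero p i = refl
  coeff-shift-hi (suc k) p i = coeff-shift-hi k p i

  *-shift : ∀ p k s → p *ₚ shift k s ≋ shift k (p *ₚ s)
  *-shift p zero s = ≋-refl
  *-shift p (suc k) s = ≋-trans (*-consʳ p 0# (shift k s))
    (≋-trans (+-congʳ (0# ∷ (p *ₚ shift k s)) (0·≋ p)) (∷-cong refl (*-shift p k s)))

  coeff-*c : ∀ r c i → coeff (r *ₚ (c ∷ [])) i ≡ c * coeff r i
  coeff-*c r c i = trans (at (*-consʳ r c []) i) (trans (coeff-+ (c ·ₚ r) (0# ∷ (r *ₚ [])) i)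
    (trans (cong (_+ coeff (0# ∷ (r *ₚ [])) i) (coeff-· c r i)) (trans (cong (c * coeff r i +_) (lem i)) (+-identityʳ _))))
    where lem : ∀ i → coeff (0# ∷ (r *ₚ [])) i ≡ 0#
          lem zero = refl
          lem (suc i) = at (*-zeroʳ r) i

  Monic : Poly → ℕ → Set
  Monic r d = HasDeg r d × coeff r d ≡ 1#

  record DivisionResult (r P : Poly) (d : ℕ) : Set where
    field
      Q R : Poly
      eq : P ≋ r *ₚ Q +ₚ R
      bnd : DegLt R d

  DegLt-mono : ∀ {P m n} → m ≤ n → DegLt P m → DegLt P n
  DegLt-mono le b j nj = b j (NP.≤-trans le nj)

  sub-add : ∀ P X → P ≋ (P -ₚ X) +ₚ X
  sub-add P X = ≋-sym (≋-trans (+ₚ-assoc P (negₚ X) X) (≋-trans (+-congˡ P (+ₚ-inverseˡ X)) (+ₚ-identityʳ P)))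

  cancel-leading-term : ∀ {r d} → Monic r d → ∀ {N} P → d ≤ N → DegLt P (suc N) →
    DegLt (P -ₚ r *ₚ shift (N ∸ d) (constₚ (coeff P N))) N
  cancel-leading-term {r} {d} m {N} P d≤N P<N+1 j N≤j =
    subst (λ x → coeff (P -ₚ r *ₚ M) x ≡ 0#) (NP.m+[n∸m]≡n N≤j) (coeff-N+ (j ∸ N))
    where
    c : Carrier
    c = coeff P N
    M : Poly
    M = shift (N ∸ d) (constₚ c)
    coeff-rM : ∀ t → coeff (r *ₚ M) (N ℕ.+ t) ≡ c * coeff r (d ℕ.+ t)
    coeff-rM t = begin
      coeff (r *ₚ M) (N ℕ.+ t)                                    ≡⟨ at (*-shift r (N ∸ d) (constₚ c)) (N ℕ.+ t) ⟩
      coeff (shift (N ∸ d) (r *ₚ constₚ c)) (N ℕ.+ t)            ≡⟨ cong (coeff (shift (N ∸ d) (r *ₚ constₚ c)))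
                                                                      (trans (cong (ℕ._+ t) (sym (NP.m∸n+n≡m d≤N))) (NP.+-assoc (N ∸ d) d t)) ⟩
      coeff (shift (N ∸ d) (r *ₚ constₚ c)) (N ∸ d ℕ.+ (d ℕ.+ t)) ≡⟨ coeff-shift-hi (N ∸ d) (r *ₚ constₚ c) (d ℕ.+ t) ⟩
      coeff (r *ₚ constₚ c) (d ℕ.+ t)                             ≡⟨ coeff-*c r c (d ℕ.+ t) ⟩
      c * coeff r (d ℕ.+ t)                                       ∎
      where open ≡-Reasoning
    top : ∀ t → coeff P (N ℕ.+ t) + - (c * coeff r (d ℕ.+ t)) ≡ 0#
    top zero rewrite NP.+-identityʳ N | NP.+-identityʳ d | proj₂ m =
      trans (cong (λ v → c + - v) (*-identityʳ c)) (-‿inverseʳ c)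
    top (suc t) rewrite P<N+1 (N ℕ.+ suc t) (NP.≤-trans (s≤s (NP.m≤m+n N t)) (NP.≤-reflexive (sym (NP.+-suc N t))))
                      | proj₂ (proj₁ m) (d ℕ.+ suc t) (NP.≤-trans (s≤s (NP.m≤m+n d t)) (NP.≤-reflexive (sym (NP.+-suc d t)))) =
      trans (cong (λ v → 0# + - v) (zeroʳ c)) (trans (+-identityˡ _) -0≡0)
    coeff-N+ : ∀ t → coeff (P -ₚ r *ₚ M) (N ℕ.+ t) ≡ 0#
    coeff-N+ t = trans (coeff-+ P (negₚ (r *ₚ M)) (N ℕ.+ t))
      (trans (cong (coeff P (N ℕ.+ t) +_) (trans (coeff-neg (r *ₚ M) (N ℕ.+ t)) (cong -_ (coeff-rM t)))) (top t))

  divide : ∀ {r d} → Monic r d → ∀ N P → DegLt P N → DivisionResult r P d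
  divide {r} {d} m zero P P<0 = record { Q = [] ; R = P ; eq = ≋-sym (+-congʳ P (*-zeroʳ r)) ; bnd = λ j _ → P<0 j z≤n }
  divide {r} {d} m (suc N) P P<N+1 with d NP.≤? N
  ... | no d≰N = record { Q = [] ; R = P ; eq = ≋-sym (+-congʳ P (*-zeroʳ r)) ; bnd = DegLt-mono {P} (NP.≰⇒> d≰N) P<N+1 }
  ... | yes d≤N = record { Q = Q′ +ₚ M ; R = R′ ; eq = P≈rQ+R ; bnd = DivisionResult.bnd rest }
    where
    M : Poly
    M = shift (N ∸ d) (constₚ (coeff P N))
    rest : DivisionResult r (P -ₚ r *ₚ M) d
    rest = divide m N (P -ₚ r *ₚ M) (cancel-leading-term {r} m P d≤N P<N+1)
    Q′ R′ : Poly
    Q′ = DivisionResult.Q rest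
    R′ = DivisionResult.R rest
    P≈rQ+R : P ≋ r *ₚ (Q′ +ₚ M) +ₚ R′
    P≈rQ+R = begin
      P                          ≈⟨ sub-add P (r *ₚ M) ⟩
      (P -ₚ r *ₚ M) +ₚ r *ₚ M    ≈⟨ +-congʳ (r *ₚ M) (DivisionResult.eq rest) ⟩
      (r *ₚ Q′ +ₚ R′) +ₚ r *ₚ M  ≈⟨ PS.solve 4 (λ r q m x → (r ⊠ q ⊞ x) ⊞ r ⊠ m ≐ r ⊠ (q ⊞ m) ⊞ x) ≋-refl r Q′ M R′ ⟩
      r *ₚ (Q′ +ₚ M) +ₚ R′       ∎
      where open ≋R

module Divisibility {q : ℕ} (𝔽 : FiniteField q) where

  open Division 𝔽 public

  infix 4 _∣_
  record _∣_ (p r : Poly) : Set where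
    constructor _,_
    field
      quo : Poly
      prf : r ≋ p *ₚ quo

  ∣-cong : ∀ {p p' r r'} → p ≋ p' → r ≋ r' → p ∣ r → p' ∣ r'
  ∣-cong {p} {p'} {r} {r'} hp hr (s , e) = s , ≋-trans (≋-sym hr) (≋-trans e (*-congʳ s hp))

  ∣-* : ∀ p s → p ∣ (p *ₚ s)
  ∣-* p s = s , ≋-refl

  ∣-trans : ∀ {p r s} → p ∣ r → r ∣ s → p ∣ s
  ∣-trans {p} {r} {s} (a , ea) (b , eb) = (a *ₚ b) , ≋-trans eb (≋-trans (*-congʳ b ea) (*ₚ-assoc p a b))

  ∣-mulʳ : ∀ {p r} s → p ∣ r → p ∣ (r *ₚ s)
  ∣-mulʳ {p} {r} s (a , e) = (a *ₚ s) , ≋-trans (*-congʳ s e) (*ₚ-assoc p a s)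

  ∣-mulˡ : ∀ {p r} s → p ∣ r → p ∣ (s *ₚ r)
  ∣-mulˡ {p} {r} s h = ∣-cong (≋-refl {p}) (*ₚ-comm r s) (∣-mulʳ s h)

  ∣-+ : ∀ {p a b} → p ∣ a → p ∣ b → p ∣ (a +ₚ b)
  ∣-+ {p} {a} {b} (x , ex) (y , ey) = (x +ₚ y) , ≋-trans (+-cong ex ey) (≋-sym (*-distribˡ p x y))

  ∣-neg : ∀ {p a} → p ∣ a → p ∣ negₚ a
  ∣-neg {p} {a} (x , ex) = negₚ x , ≋-trans (neg-cong ex) (≋-sym (neg-*ʳ p x))

  ∣-sub : ∀ {p a b} → p ∣ a → p ∣ b → p ∣ (a -ₚ b)
  ∣-sub ha hb = ∣-+ ha (∣-neg hb)

  1∣ : ∀ r → 1ₚ ∣ r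
  1∣ r = r , ≋-sym (*-identityˡₚ r)

  ∣-cancel : ∀ {p a b} → Nonzero p → (p *ₚ a) ∣ (p *ₚ b) → a ∣ b
  ∣-cancel {p} {a} {b} hp (s , e) = s , cancelˡ hp (≋-trans e (*ₚ-assoc p a s))

  *-monoʳ-∣ : ∀ p {a b} → a ∣ b → (p *ₚ a) ∣ (p *ₚ b)
  *-monoʳ-∣ p {a} {b} (s , b≈as) = s , ≋-trans (*-congˡ p b≈as) (≋-sym (*ₚ-assoc p a s))

  *-pres-∣ : ∀ {a b c d} → a ∣ b → c ∣ d → (a *ₚ c) ∣ (b *ₚ d)
  *-pres-∣ {a} {b} {c} {d} (x , b≈ax) (y , d≈cy) = (x *ₚ y) , ≋-trans (*-cong b≈ax d≈cy)
    (PS.solve 4 (λ a x c y → (a ⊠ x) ⊠ (c ⊠ y) ≐ (a ⊠ c) ⊠ (x ⊠ y)) ≋-refl a x c y)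

  ^-∣-^ : ∀ p {a b} → a ≤ b → (p ^ₚ a) ∣ (p ^ₚ b)
  ^-∣-^ p {a} {b} a≤b = ∣-cong (≋-refl {p ^ₚ a}) (≋-sym (≋-trans (≡⇒≋ (cong (p ^ₚ_) (sym (NP.m+[n∸m]≡n a≤b)))) (pow-+ p a (b ∸ a))))
    (∣-* (p ^ₚ a) (p ^ₚ (b ∸ a)))

  add-sub : ∀ a b → (a +ₚ b) -ₚ a ≋ b
  add-sub a b = ≋-trans (+-congʳ (negₚ a) (+ₚ-comm a b)) (≋-trans (+ₚ-assoc b a (negₚ a))
    (≋-trans (+-congˡ b (+ₚ-inverseʳ a)) (+ₚ-identityʳ b)))

  DegLt⇒deg< : ∀ {R d e} → DegLt R d → HasDeg R e → e < d
  DegLt⇒deg< {R} {d} {e} b (nz , _) with d NP.≤? e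
  ... | yes le = ⊥-elim (nz (b e le))
  ... | no nle = NP.≰⇒> nle

  DegLt-length : ∀ P → DegLt P (length P)
  DegLt-length P j h = coeff-len P j h

  ∣? : ∀ {r d} → Monic r d → ∀ P → Dec (r ∣ P)
  ∣? {r} {d} m P with divide {r} {d} m (length P) P (DegLt-length P)
  ... | D with degView (DivisionResult.R D)
  ...   | inj₁ z = yes (DivisionResult.Q D , ≋-trans (DivisionResult.eq D) (≋-trans (+-congˡ (r *ₚ DivisionResult.Q D) z) (+ₚ-identityʳ _)))
  ...   | inj₂ (e , de) = no λ { (S , eS) → contra S eS }
    where
    Q R : Poly
    Q = DivisionResult.Q D
    R = DivisionResult.R D
    contra : ∀ S → P ≋ r *ₚ S → ⊥
    contra S eS with degView (S -ₚ Q)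
    ... | inj₁ z = HasDeg⇒nonzero {R} de (≋-trans eqR (≋-trans (*-congˡ r z) (*-zeroʳ r)))
      where
      eqR : R ≋ r *ₚ (S -ₚ Q)
      eqR = ≋-trans (≋-sym (add-sub (r *ₚ Q) R)) (≋-trans (+-congʳ (negₚ (r *ₚ Q)) (≋-sym (DivisionResult.eq D)))
            (≋-trans (+-congʳ (negₚ (r *ₚ Q)) eS) (≋-sym (PRP.x[y-z]≈xy-xz r S Q))))
    ... | inj₂ (f , df) = NP.<⇒≱ lt (NP.≤-trans (NP.m≤m+n d f) (NP.≤-reflexive (sym eq)))
      where
      eqR : R ≋ r *ₚ (S -ₚ Q)
      eqR = ≋-trans (≋-sym (add-sub (r *ₚ Q) R)) (≋-trans (+-congʳ (negₚ (r *ₚ Q)) (≋-sym (DivisionResult.eq D)))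
            (≋-trans (+-congʳ (negₚ (r *ₚ Q)) eS) (≋-sym (PRP.x[y-z]≈xy-xz r S Q))))
      lt : e < d
      lt = DegLt⇒deg< {R} (DivisionResult.bnd D) de
      eq : e ≡ d ℕ.+ f
      eq = deg-unique {R} de (HasDeg-cong {r *ₚ (S -ₚ Q)} (≋-sym eqR) (HasDeg-* {r} {S -ₚ Q} (proj₁ m) df))

module EuclidsLemma {q : ℕ} (𝔽 : FiniteField q) where

  open Divisibility 𝔽 public

  [c]* : ∀ c X → (c ∷ []) *ₚ X ≋ c ·ₚ X
  [c]* c X = ≋-trans (+-congˡ (c ·ₚ X) ⟨ (λ { zero → refl ; (suc j) → refl }) ⟩) (+ₚ-identityʳ (c ·ₚ X))

  constₚ-* : ∀ x y → constₚ (x * y) ≋ constₚ x *ₚ constₚ y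
  constₚ-* x y = ≋-sym ([c]* x (constₚ y))

  coeff-constₚ : ∀ x j → 1 ≤ j → coeff (constₚ x) j ≡ 0#
  coeff-constₚ x (suc j) _ = refl

  ·-assoc : ∀ c d X → c ·ₚ (d ·ₚ X) ≋ (c * d) ·ₚ X
  ·-assoc c d X = ⟨ (λ j → trans (coeff-· c (d ·ₚ X) j) (trans (cong (c *_) (coeff-· d X j))
    (trans (sym (*-assoc _ _ _)) (sym (coeff-· (c * d) X j))))) ⟩

  inv-·-cancel : ∀ c (h : ¬ c ≡ 0#) X → inv c h ·ₚ (c ·ₚ X) ≋ X
  inv-·-cancel c h X = ≋-trans (·-assoc (inv c h) c X) (≋-trans (·-cong (inv-l c h) (≋-refl {X})) (1·≋ X))

  ·-inv-cancel : ∀ c (h : ¬ c ≡ 0#) X → c ·ₚ (inv c h ·ₚ X) ≋ X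
  ·-inv-cancel c h X = ≋-trans (·-assoc c (inv c h) X) (≋-trans (·-cong (inv-correct c h) (≋-refl {X})) (1·≋ X))

  ∣-scale : ∀ {p X} d → p ∣ X → p ∣ (d ·ₚ X)
  ∣-scale {p} {X} d h = ∣-cong (≋-refl {p}) ([c]* d X) (∣-mulˡ (d ∷ []) h)

  unscale-∣ : ∀ {p X c} → ¬ c ≡ 0# → p ∣ (c ·ₚ X) → p ∣ X
  unscale-∣ {p} {X} {c} h d = ∣-cong (≋-refl {p}) (inv-·-cancel c h X) (∣-scale (inv c h) d)

  unit-∣ : ∀ {c} → ¬ c ≡ 0# → ∀ X → (c ∷ []) ∣ X
  unit-∣ {c} h X = (inv c h ·ₚ X) , ≋-sym (≋-trans ([c]* c (inv c h ·ₚ X)) (·-inv-cancel c h X))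

  const-≋ : ∀ p → IsConstant p → p ≋ (coeff p 0 ∷ [])
  const-≋ p h = ⟨ (λ { zero → refl ; (suc j) → h (suc j) (s≤s z≤n) }) ⟩

  IsConstant⇒¬HasDeg-suc : ∀ {p n} → IsConstant p → HasDeg p (suc n) → ⊥
  IsConstant⇒¬HasDeg-suc {p} {n} h (nz , _) = nz (h (suc n) (s≤s z≤n))

  HasDeg0-const : ∀ {p} → HasDeg p 0 → IsConstant p
  HasDeg0-const (_ , hi) = hi

  *-const : ∀ X c → X *ₚ (c ∷ []) ≋ c ·ₚ X
  *-const X c = ≋-trans (*ₚ-comm X (c ∷ [])) ([c]* c X)

  monicAssociate : ∀ p n → HasDeg p n → Σ Poly (λ p' → Monic p' n × p ≋ coeff p n ·ₚ p')
  monicAssociate p n hd@(nz , hi) = p' , ((nz' , hi') , lc1) , ≋-sym (·-inv-cancel c nz p)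
    where
    c : Carrier
    c = coeff p n
    p' : Poly
    p' = inv c nz ·ₚ p
    lc1 : coeff p' n ≡ 1#
    lc1 = trans (coeff-· (inv c nz) p n) (inv-l c nz)
    nz' : ¬ coeff p' n ≡ 0#
    nz' e = 1≢0 (trans (sym lc1) e)
    hi' : ∀ j → n < j → coeff p' j ≡ 0#
    hi' j lt = trans (coeff-· (inv c nz) p j) (trans (cong (inv c nz *_) (hi j lt)) (zeroʳ _))

  Irreducible : Poly → Set
  Irreducible p = ∀ r s → p ≋ r *ₚ s → IsConstant r ⊎ IsConstant s

  module Euclid {p n} (mp : Monic p (suc n)) (ip : Irreducible p) (B : Poly) where

    hp : HasDeg p (suc n)
    hp = proj₁ mp

    -- Dividing p by R leaves a remainder S of smaller degree with p ∣ S·B; a zero remainder would make R a proper factor of p.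
    cancel-low-degree : ∀ K k R → k < K → HasDeg R k → k ≤ n → p ∣ (R *ₚ B) → p ∣ B
    cancel-low-degree (suc K) zero R lt hR kn d =
      unscale-∣ (proj₁ hR) (∣-cong (≋-refl {p}) (≋-trans (*-congʳ B (const-≋ R (HasDeg0-const {R} hR))) ([c]* (coeff R 0) B)) d)
    cancel-low-degree (suc K) (suc k) R (s≤s lt) hR kn d with monicAssociate R (suc k) hR
    ... | R' , mR' , eR with divide {R'} {suc k} mR' (length p) p (DegLt-length p)
    ...   | D with degView (DivisionResult.R D)
    ...     | inj₁ z = ⊥-elim (contra (ip R' Q pRQ))
      where
      Q : Poly
      Q = DivisionResult.Q D
      pRQ : p ≋ R' *ₚ Q
      pRQ = ≋-trans (DivisionResult.eq D) (≋-trans (+-congˡ (R' *ₚ Q) z) (+ₚ-identityʳ _))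
      contra : IsConstant R' ⊎ IsConstant Q → ⊥
      contra (inj₁ cR) = IsConstant⇒¬HasDeg-suc {R'} cR (proj₁ mR')
      contra (inj₂ cQ) = NP.<-irrefl (sym deq) kn
        where
        Q0nz : ¬ coeff Q 0 ≡ 0#
        Q0nz e = HasDeg⇒nonzero {p} hp (≋-trans pRQ (≋-trans (*-congˡ R' (≋-trans (const-≋ Q cQ) ⟨ (λ { zero → e ; (suc j) → refl }) ⟩)) (*-zeroʳ R')))
        hQ : HasDeg Q 0
        hQ = Q0nz , cQ
        deq : n ≡ k
        deq = NP.suc-injective (trans (deg-unique {p} hp (HasDeg-cong {R' *ₚ Q} (≋-sym pRQ) (HasDeg-* {R'} {Q} (proj₁ mR') hQ))) (NP.+-identityʳ (suc k)))
    ...     | inj₂ (e , de) = cancel-low-degree K e S (NP.≤-trans (DegLt⇒deg< {S} (DivisionResult.bnd D) de) lt) de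
                                (NP.≤-trans (NP.<⇒≤ (DegLt⇒deg< {S} (DivisionResult.bnd D) de)) kn) dSB
      where
      Q S : Poly
      Q = DivisionResult.Q D
      S = DivisionResult.R D
      c : Carrier
      c = coeff R (suc k)
      dR'B : p ∣ (R' *ₚ B)
      dR'B = unscale-∣ (proj₁ hR) (∣-cong (≋-refl {p}) (≋-trans (*-congʳ B eR) (·-*ˡ c R' B)) d)
      eS : S ≋ p -ₚ R' *ₚ Q
      eS = ≋-trans (≋-sym (add-sub (R' *ₚ Q) S)) (+-congʳ (negₚ (R' *ₚ Q)) (≋-sym (DivisionResult.eq D)))
      eSB : S *ₚ B ≋ p *ₚ B -ₚ Q *ₚ (R' *ₚ B)
      eSB = ≋-trans (*-congʳ B eS) (≋-trans (PRP.[y-z]x≈yx-zx B p (R' *ₚ Q))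
              (+-congˡ (p *ₚ B) (neg-cong (PS.solve 3 (λ r q b → (r ⊠ q) ⊠ b ≐ q ⊠ (r ⊠ b)) ≋-refl R' Q B))))
      dSB : p ∣ (S *ₚ B)
      dSB = ∣-cong (≋-refl {p}) (≋-sym eSB) (∣-sub (∣-* p B) (∣-mulˡ Q dR'B))

    euclid : ∀ X → p ∣ (X *ₚ B) → ¬ (p ∣ X) → p ∣ B
    euclid X d np with divide {p} {suc n} mp (length X) X (DegLt-length X)
    ... | D with degView (DivisionResult.R D)
    ...   | inj₁ z = ⊥-elim (np (DivisionResult.Q D , ≋-trans (DivisionResult.eq D) (≋-trans (+-congˡ (p *ₚ DivisionResult.Q D) z) (+ₚ-identityʳ _))))
    ...   | inj₂ (e , de) = cancel-low-degree (suc e) e R (NP.n<1+n e) de (NP.≤-pred (DegLt⇒deg< {R} (DivisionResult.bnd D) de)) dRB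
      where
      Q R : Poly
      Q = DivisionResult.Q D
      R = DivisionResult.R D
      eR : R ≋ X -ₚ p *ₚ Q
      eR = ≋-trans (≋-sym (add-sub (p *ₚ Q) R)) (+-congʳ (negₚ (p *ₚ Q)) (≋-sym (DivisionResult.eq D)))
      eRB : R *ₚ B ≋ X *ₚ B -ₚ p *ₚ (Q *ₚ B)
      eRB = ≋-trans (*-congʳ B eR) (≋-trans (PRP.[y-z]x≈yx-zx B X (p *ₚ Q))
              (+-congˡ (X *ₚ B) (neg-cong (*ₚ-assoc p Q B))))
      dRB : p ∣ (R *ₚ B)
      dRB = ∣-cong (≋-refl {p}) (≋-sym eRB) (∣-sub d (∣-* p (Q *ₚ B)))

  euclid : ∀ {p n} → Monic p (suc n) → Irreducible p → ∀ X B → p ∣ (X *ₚ B) → ¬ (p ∣ X) → p ∣ B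
  euclid mp ip X B = Euclid.euclid mp ip B X

  euclid-^ : ∀ {p n} → Monic p (suc n) → Irreducible p → ∀ Y → ¬ (p ∣ Y) → ∀ e B → (p ^ₚ e) ∣ (Y *ₚ B) → (p ^ₚ e) ∣ B
  euclid-^ {p} mp ip Y nY zero B d = 1∣ B
  euclid-^ {p} mp ip Y nY (suc e) B d with euclid mp ip Y B (∣-trans (∣-* p (p ^ₚ e)) d) nY
  ... | B' , eB = ∣-cong (≋-refl {p ^ₚ suc e}) (≋-sym eB) (∣-cong (≋-sym (≋-refl {p *ₚ p ^ₚ e})) ≋-refl
        (*-monoʳ-∣ p (euclid-^ mp ip Y nY e B' (∣-cancel (HasDeg⇒nonzero {p} (proj₁ mp)) d'))))
    where
    d' : (p *ₚ p ^ₚ e) ∣ (p *ₚ (Y *ₚ B'))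
    d' = ∣-cong (≋-refl {p *ₚ p ^ₚ e}) (≋-trans (*-congˡ Y eB) (PS.solve 3 (λ y p b → y ⊠ (p ⊠ b) ≐ p ⊠ (y ⊠ b)) ≋-refl Y p B')) d

module Factorisation {q : ℕ} (𝔽 : FiniteField q) where

  open EuclidsLemma 𝔽 public
  open import Data.Fin using (Fin)
  import Data.Fin.Properties as FP
  open import Data.Vec using (Vec; []; _∷_)
  open import Function.Bundles using (Inverse)

  toF : Carrier → Fin q
  toF = Inverse.to enumeration
  fromF : Fin q → Carrier
  fromF = Inverse.from enumeration
  from-to : ∀ x → fromF (toF x) ≡ x
  from-to x = Inverse.strictlyInverseʳ enumeration x
  to-from : ∀ i → toF (fromF i) ≡ i
  to-from i = Inverse.strictlyInverseˡ enumeration i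

  any?-Carrier : {P : Carrier → Set} → (∀ x → Dec (P x)) → Dec (Σ Carrier P)
  any?-Carrier {P} P? with FP.any? (λ i → P? (fromF i))
  ... | yes (i , p) = yes (fromF i , p)
  ... | no n = no (λ { (x , px) → n (toF x , subst P (sym (from-to x)) px) })

  any?-Vec : ∀ d {P : Vec Carrier d → Set} → (∀ v → Dec (P v)) → Dec (Σ (Vec Carrier d) P)
  any?-Vec zero P? with P? []
  ... | yes p = yes ([] , p)
  ... | no n = no (λ { ([] , p) → n p })
  any?-Vec (suc d) P? with any?-Carrier (λ x → any?-Vec d (λ v → P? (x ∷ v)))
  ... | yes (x , v , p) = yes (x ∷ v , p)
  ... | no n = no (λ { (x ∷ v , p) → n (x , v , p) })

  any?-< : ∀ n {P : ℕ → Set} → (∀ d → Dec (P d)) → Dec (Σ ℕ (λ d → d < n × P d))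
  any?-< zero P? = no (λ { (d , () , _) })
  any?-< (suc n) P? with P? n
  ... | yes p = yes (n , NP.≤-refl , p)
  ... | no np with any?-< n P?
  ...   | yes (d , lt , p) = yes (d , NP.m≤n⇒m≤1+n lt , p)
  ...   | no nn = no (λ { (d , lt , p) → lem d lt p })
    where
    lem : ∀ d → d < suc n → _ → ⊥
    lem d lt p with NP.m≤n⇒m<n∨m≡n (NP.≤-pred lt)
    ... | inj₁ l = nn (d , l , p)
    ... | inj₂ refl = np p

  monicFrom : ∀ {d} → Vec Carrier d → Poly
  monicFrom [] = 1# ∷ []
  monicFrom (x ∷ v) = x ∷ monicFrom v

  monicFrom-monic : ∀ {d} (v : Vec Carrier d) → Monic (monicFrom v) d
  monicFrom-monic [] = (1≢0 , λ { zero () ; (suc j) _ → refl }) , refl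
  monicFrom-monic (x ∷ v) with monicFrom-monic v
  ... | (nz , hi) , lc = (nz , λ { zero () ; (suc j) (s≤s lt) → hi j lt }) , lc

  tailₚ : Poly → Poly
  tailₚ [] = []
  tailₚ (a ∷ p) = p

  coeff-tailₚ : ∀ p j → coeff (tailₚ p) j ≡ coeff p (suc j)
  coeff-tailₚ [] j = refl
  coeff-tailₚ (a ∷ p) j = refl

  lowerCoeffs : ∀ d → Poly → Vec Carrier d
  lowerCoeffs zero p = []
  lowerCoeffs (suc d) p = coeff p 0 ∷ lowerCoeffs d (tailₚ p)

  monicFrom-lowerCoeffs : ∀ d p → Monic p d → monicFrom (lowerCoeffs d p) ≋ p
  monicFrom-lowerCoeffs zero p ((nz , hi) , lc) = ⟨ (λ { zero → sym lc ; (suc j) → sym (hi (suc j) (s≤s z≤n)) }) ⟩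
  monicFrom-lowerCoeffs (suc d) p ((nz , hi) , lc) =
    ⟨ (λ { zero → refl ; (suc j) → trans (at (monicFrom-lowerCoeffs d (tailₚ p) mt) j) (coeff-tailₚ p j) }) ⟩
    where
    mt : Monic (tailₚ p) d
    mt = ((λ e → nz (trans (sym (coeff-tailₚ p d)) e)) , λ j lt → trans (coeff-tailₚ p j) (hi (suc j) (s≤s lt))) ,
         trans (coeff-tailₚ p d) lc

  HasIrreducibleFactor : Poly → Set
  HasIrreducibleFactor h = Σ Poly (λ p → Σ ℕ (λ m → Monic p (suc m) × Irreducible p × p ∣ h))

  deg-* : ∀ {h r s a b c} → h ≋ r *ₚ s → HasDeg h a → HasDeg r b → HasDeg s c → a ≡ b ℕ.+ c
  deg-* {h} {r} {s} e hh hr hs = deg-unique {h} hh (HasDeg-cong {r *ₚ s} (≋-sym e) (HasDeg-* {r} {s} hr hs))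

  irreducibleFactor : ∀ K n h → n < K → HasDeg h (suc n) → HasIrreducibleFactor h
  irreducibleFactor (suc K) n h (s≤s lt) hh with any?-< n (λ d → any?-Vec (suc d) (λ v → ∣? {monicFrom v} {suc d} (monicFrom-monic v) h))
  ... | yes (d , d<n , v , dv) with irreducibleFactor K d (monicFrom v) (NP.≤-trans d<n lt) (proj₁ (monicFrom-monic v))
  ...   | p , m , mp , ip , pd = p , m , mp , ip , ∣-trans pd dv
  irreducibleFactor (suc K) n h (s≤s lt) hh | no nf = h' , n , mh' , irr , h'∣h
    where
    N : Σ Poly (λ h′ → Monic h′ (suc n) × h ≋ coeff h (suc n) ·ₚ h′)
    N = monicAssociate h (suc n) hh
    h' : Poly
    h' = proj₁ N
    mh' : Monic h' (suc n)
    mh' = proj₁ (proj₂ N)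
    c : Carrier
    c = coeff h (suc n)
    h'∣h : h' ∣ h
    h'∣h = (c ∷ []) , ≋-trans (proj₂ (proj₂ N)) (≋-sym (*-const h' c))
    irr : Irreducible h'
    irr r s e with degView r | degView s
    ... | inj₁ z | _ = ⊥-elim (HasDeg⇒nonzero {h'} (proj₁ mh') (≋-trans e (≋-trans (*-congʳ s z) ≋-refl)))
    ... | inj₂ _ | inj₁ z = ⊥-elim (HasDeg⇒nonzero {h'} (proj₁ mh') (≋-trans e (≋-trans (*-congˡ r z) (*-zeroʳ r))))
    ... | inj₂ (zero , hr) | inj₂ _ = inj₁ (HasDeg0-const {r} hr)
    ... | inj₂ (suc dr , hr) | inj₂ (zero , hs) = inj₂ (HasDeg0-const {s} hs)
    ... | inj₂ (suc dr , hr) | inj₂ (suc ds , hs) = ⊥-elim (nf (dr , dr<n , lowerCoeffs (suc dr) r' , dv))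
      where
      deq : suc n ≡ suc dr ℕ.+ suc ds
      deq = deg-* {h'} {r} {s} e (proj₁ mh') hr hs
      dr<n : dr < n
      dr<n = NP.≤-trans (NP.≤-trans (s≤s (NP.m≤m+n dr ds)) (NP.≤-reflexive (sym (NP.+-suc dr ds))))
               (NP.≤-reflexive (sym (NP.suc-injective deq)))
      Nr : Σ Poly (λ r′ → Monic r′ (suc dr) × r ≋ coeff r (suc dr) ·ₚ r′)
      Nr = monicAssociate r (suc dr) hr
      r' : Poly
      r' = proj₁ Nr
      mr' : Monic r' (suc dr)
      mr' = proj₁ (proj₂ Nr)
      r'∣r : r' ∣ r
      r'∣r = (coeff r (suc dr) ∷ []) , ≋-trans (proj₂ (proj₂ Nr)) (≋-sym (*-const r' _))
      dv : monicFrom (lowerCoeffs (suc dr) r') ∣ h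
      dv = ∣-cong (≋-sym (monicFrom-lowerCoeffs (suc dr) r' mr')) ≋-refl (∣-trans r'∣r (∣-trans (s , e) h'∣h))

  monic-associates-≋ : ∀ {p p' m m' s} → Monic p (suc m) → Monic p' (suc m') → p ≋ p' *ₚ s → IsConstant s → p ≋ p'
  monic-associates-≋ {p} {p'} {m} {m'} {s} mp mp' e cs = ≋-trans e2 (≋-trans (·-cong s0≡1 (≋-refl {p'})) (1·≋ p'))
    where
    s0 : Carrier
    s0 = coeff s 0
    e2 : p ≋ s0 ·ₚ p'
    e2 = ≋-trans e (≋-trans (*-congˡ p' (const-≋ s cs)) (*-const p' s0))
    s0nz : ¬ s0 ≡ 0#
    s0nz z = HasDeg⇒nonzero {p} (proj₁ mp) (≋-trans e2 ⟨ (λ j → trans (coeff-· s0 p' j) (trans (cong (_* coeff p' j) z) (zeroˡ _))) ⟩)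
    hd : HasDeg p (suc m')
    hd = HasDeg-cong {s0 ·ₚ p'} (≋-sym e2)
          ((λ z → *-nonzero s0nz (proj₁ (proj₁ mp')) (trans (sym (coeff-· s0 p' (suc m'))) z)) ,
           λ j lt → trans (coeff-· s0 p' j) (trans (cong (s0 *_) (proj₂ (proj₁ mp') j lt)) (zeroʳ _)))
    meq : suc m ≡ suc m'
    meq = deg-unique {p} (proj₁ mp) hd
    s0≡1 : s0 ≡ 1#
    s0≡1 = begin
      s0 ≡⟨ sym (*-identityʳ s0) ⟩
      s0 * 1# ≡⟨ cong (s0 *_) (sym (proj₂ mp')) ⟩
      s0 * coeff p' (suc m') ≡⟨ sym (coeff-· s0 p' (suc m')) ⟩
      coeff (s0 ·ₚ p') (suc m') ≡⟨ sym (at e2 (suc m')) ⟩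
      coeff p (suc m') ≡⟨ cong (coeff p) (sym meq) ⟩
      coeff p (suc m) ≡⟨ proj₂ mp ⟩
      1# ∎
      where open ≡-Reasoning

  PrimePowersDivide : Poly → Poly → Set
  PrimePowersDivide h X = ∀ p m → Monic p (suc m) → Irreducible p → ∀ e → (p ^ₚ e) ∣ h → (p ^ₚ e) ∣ X

  prime-powers⇒∣-bounded : ∀ K d h → d < K → HasDeg h d → ∀ X → PrimePowersDivide h X → h ∣ X
  prime-powers⇒∣-bounded (suc K) zero h _ hh X H = ∣-cong (≋-sym (const-≋ h (HasDeg0-const {h} hh))) (≋-refl {X}) (unit-∣ (proj₁ hh) X)
  prime-powers⇒∣-bounded (suc K) (suc n) h (s≤s lt) hh X H with irreducibleFactor (suc n) n h NP.≤-refl hh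
  ... | p , m , mp , ip , (h₁ , eh) with degView h₁
  ...   | inj₁ z = ⊥-elim (HasDeg⇒nonzero {h} hh (≋-trans eh (≋-trans (*-congˡ p z) (*-zeroʳ p))))
  ...   | inj₂ (d₁ , hd₁) = ∣-cong (≋-sym eh) (≋-sym eX) (*-monoʳ-∣ p (prime-powers⇒∣-bounded K d₁ h₁ d₁<K hd₁ X₁ H'))
    where
    hp : HasDeg p (suc m)
    hp = proj₁ mp
    np : Nonzero p
    np = HasDeg⇒nonzero {p} hp
    deq : suc n ≡ suc m ℕ.+ d₁
    deq = deg-* {h} {p} {h₁} eh hh hp hd₁
    d₁<K : d₁ < K
    d₁<K = NP.≤-trans (s≤s (NP.≤-trans (NP.m≤n+m d₁ m) (NP.≤-reflexive (NP.suc-injective (sym deq))))) lt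
    p∣X : p ∣ X
    p∣X = ∣-cong (*-identityʳₚ p) (≋-refl {X}) (H p m mp ip 1 (∣-cong (≋-sym (*-identityʳₚ p)) (≋-refl {h}) (h₁ , eh)))
    X₁ : Poly
    X₁ = _∣_.quo p∣X
    eX : X ≋ p *ₚ X₁
    eX = _∣_.prf p∣X
    H' : PrimePowersDivide h₁ X₁
    H' p' m' mp' ip' e d with ∣? {p'} {suc m'} mp' p
    ... | yes (s , es) with ip p' s es
    ...   | inj₁ cp' = ⊥-elim (IsConstant⇒¬HasDeg-suc {p'} cp' (proj₁ mp'))
    ...   | inj₂ cs = ∣-cong (^-cong e pp') (≋-refl {X₁})
              (∣-cancel np (∣-cong (≋-refl {p *ₚ p ^ₚ e}) eX (H p m mp ip (suc e)
                (∣-cong (≋-refl {p *ₚ p ^ₚ e}) (≋-sym eh) (*-monoʳ-∣ p (∣-cong (^-cong e (≋-sym pp')) (≋-refl {h₁}) d))))))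
      where
      pp' : p ≋ p'
      pp' = monic-associates-≋ {p} {p'} mp mp' es cs
    H' p' m' mp' ip' e d | no np' =
      euclid-^ mp' ip' p np' e X₁ (∣-cong (≋-refl {p' ^ₚ e}) eX (H p' m' mp' ip' e
        (∣-trans d (∣-cong (≋-refl {h₁}) (≋-trans (*ₚ-comm h₁ p) (≋-sym eh)) (∣-* h₁ p)))))

  prime-powers⇒∣ : ∀ {h d} → HasDeg h d → ∀ X → PrimePowersDivide h X → h ∣ X
  prime-powers⇒∣ {h} {d} hh = prime-powers⇒∣-bounded (suc d) d h NP.≤-refl hh

module FermatsLittleTheorem {q : ℕ} (𝔽 : FiniteField q) where

  open Factorisation 𝔽 public
  open import Data.Fin using (Fin; zero; suc)
  open import Function.Bundles using (Inverse; mk↔ₛ′)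
  import Algebra.Properties.CommutativeMonoid.Sum as CMSum

  module M = CMSum (CommutativeRing.*-commutativeMonoid fieldRing)

  Π : ∀ {n} → (Fin n → Carrier) → Carrier
  Π = M.sum

  Π-cong : ∀ {n} (f g : Fin n → Carrier) → (∀ i → f i ≡ g i) → Π f ≡ Π g
  Π-cong {zero} f g h = refl
  Π-cong {suc n} f g h = cong₂ _*_ (h zero) (Π-cong (f ∘ suc) (g ∘ suc) (h ∘ suc))

  Π-* : ∀ {n} (f g : Fin n → Carrier) → Π (λ i → f i * g i) ≡ Π f * Π g
  Π-* f g = M.∑-distrib-+ f g

  Π-const : ∀ n x → Π {n} (λ _ → x) ≡ x ^ n
  Π-const zero x = refl
  Π-const (suc n) x = cong (x *_) (Π-const n x)

  Π-ones : ∀ n (f : Fin n → Carrier) → (∀ j → f j ≡ 1#) → Π f ≡ 1#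
  Π-ones zero f h = refl
  Π-ones (suc n) f h = trans (cong₂ _*_ (h zero) (Π-ones n (f ∘ suc) (h ∘ suc))) (*-identityʳ _)

  Π-except : ∀ n (f : Fin n → Carrier) i → (∀ j → ¬ j ≡ i → f j ≡ 1#) → Π f ≡ f i
  Π-except (suc n) f zero h = trans (cong (f zero *_) (Π-ones n (f ∘ suc) (λ j → h (suc j) (λ ())))) (*-identityʳ _)
  Π-except (suc n) f (suc i) h = trans (cong₂ _*_ (h zero (λ ())) (Π-except n (f ∘ suc) i (λ j ne → h (suc j) (λ e → ne (Data.Fin.Properties.suc-injective e))))) (*-identityˡ _)
    where import Data.Fin.Properties

  Π-nonzero : ∀ n (f : Fin n → Carrier) → (∀ i → ¬ f i ≡ 0#) → ¬ Π f ≡ 0#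
  Π-nonzero zero f h = 1≢0
  Π-nonzero (suc n) f h = *-nonzero (h zero) (Π-nonzero n (f ∘ suc) (h ∘ suc))

  enumeration-size≥2 : ∀ n (t : Carrier → Fin n) (f : Fin n → Carrier) → (∀ x → f (t x) ≡ x) → Σ ℕ (λ q' → n ≡ suc (suc q'))
  enumeration-size≥2 zero t f h with t 0#
  ... | ()
  enumeration-size≥2 (suc zero) t f h with t 0# | t 1# | inspect t 0# | inspect t 1#
  ... | zero | zero | [ e0 ] | [ e1 ] = ⊥-elim (0≢1 (trans (sym (h 0#)) (trans (cong f (trans e0 (sym e1))) (h 1#))))
  enumeration-size≥2 (suc (suc q')) t f h = q' , refl

  q≡2+ : Σ ℕ (λ q' → q ≡ suc (suc q'))
  q≡2+ = enumeration-size≥2 q toF fromF from-to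

  *-cancelʳ-nonzero : ∀ {a b c} → ¬ c ≡ 0# → a * c ≡ b * c → a ≡ b
  *-cancelʳ-nonzero {a} {b} {c} nc e = begin
    a ≡⟨ sym (*-identityʳ a) ⟩
    a * 1# ≡⟨ cong (a *_) (sym (inv-correct c nc)) ⟩
    a * (c * inv c nc) ≡⟨ sym (*-assoc _ _ _) ⟩
    (a * c) * inv c nc ≡⟨ cong (_* inv c nc) e ⟩
    (b * c) * inv c nc ≡⟨ *-assoc _ _ _ ⟩
    b * (c * inv c nc) ≡⟨ cong (b *_) (inv-correct c nc) ⟩
    b * 1# ≡⟨ *-identityʳ b ⟩
    b ∎
    where open ≡-Reasoning

  -- With P = ∏_y φ(y) ≠ 0 (φ replaces 0 by 1): y ↦ xy permutes 𝔽, so x^q·P = ∏_y φ(xy)·correction(y) = P·x.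
  module Fermat (x : Carrier) (nx : ¬ x ≡ 0#) where
    φ : Carrier → Carrier
    φ y with y ≟ 0#
    ... | yes _ = 1#
    ... | no _ = y

    φ-nonzero : ∀ y → ¬ φ y ≡ 0#
    φ-nonzero y with y ≟ 0#
    ... | yes _ = 1≢0
    ... | no n = n

    correction : Carrier → Carrier
    correction y with y ≟ 0#
    ... | yes _ = x
    ... | no _ = 1#

    φ-* : ∀ y → φ (x * y) * correction y ≡ x * φ y
    φ-* y with y ≟ 0#
    φ-* y | yes refl with (x * 0#) ≟ 0#
    ... | yes _ = trans (*-identityˡ x) (sym (*-identityʳ x))
    ... | no n = ⊥-elim (n (zeroʳ x))
    φ-* y | no ny with (x * y) ≟ 0#
    ... | yes e = ⊥-elim (*-nonzero nx ny e)
    ... | no _ = *-identityʳ _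

    σ : Fin q → Fin q
    σ i = toF (x * fromF i)
    σ⁻ : Fin q → Fin q
    σ⁻ i = toF (inv x nx * fromF i)

    π : Fin q Function.Bundles.↔ Fin q
    π = mk↔ₛ′ σ σ⁻ (λ i → trans (cong (λ v → toF (x * v)) (from-to _))
                             (trans (cong toF (trans (sym (*-assoc _ _ _)) (trans (cong (_* fromF i) (inv-correct x nx)) (*-identityˡ _)))) (to-from i)))
                     (λ i → trans (cong (λ v → toF (inv x nx * v)) (from-to _))
                             (trans (cong toF (trans (sym (*-assoc _ _ _)) (trans (cong (_* fromF i) (inv-l x nx)) (*-identityˡ _)))) (to-from i)))

    P : Carrier
    P = Π (φ ∘ fromF)

    ∏-φ-permuted : Π (λ i → φ (x * fromF i)) ≡ P
    ∏-φ-permuted = sym (trans (M.sum-permute (φ ∘ fromF) π) (Π-cong _ _ (λ i → cong φ (from-to (x * fromF i)))))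

    ∏-correction : Π (correction ∘ fromF) ≡ x
    ∏-correction = trans (Π-except q (correction ∘ fromF) (toF 0#) ones) (trans (cong correction (from-to 0#)) e0)
      where
      e0 : correction 0# ≡ x
      e0 with 0# ≟ 0#
      ... | yes _ = refl
      ... | no n = ⊥-elim (n refl)
      ones : ∀ j → ¬ j ≡ toF 0# → correction (fromF j) ≡ 1#
      ones j ne with fromF j ≟ 0#
      ... | yes e = ⊥-elim (ne (trans (sym (to-from j)) (cong toF e)))
      ... | no _ = refl

    x^q*P≡x*P : x ^ q * P ≡ x * P
    x^q*P≡x*P = begin
      x ^ q * P ≡⟨ cong (_* P) (sym (Π-const q x)) ⟩
      Π {q} (λ _ → x) * P ≡⟨ sym (Π-* {q} (λ _ → x) (φ ∘ fromF)) ⟩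
      Π (λ i → x * φ (fromF i)) ≡⟨ Π-cong _ _ (λ i → sym (φ-* (fromF i))) ⟩
      Π (λ i → φ (x * fromF i) * correction (fromF i)) ≡⟨ Π-* (λ i → φ (x * fromF i)) (correction ∘ fromF) ⟩
      Π (λ i → φ (x * fromF i)) * Π (correction ∘ fromF) ≡⟨ cong₂ _*_ ∏-φ-permuted ∏-correction ⟩
      P * x ≡⟨ *-comm P x ⟩
      x * P ∎
      where open ≡-Reasoning

    fermat : x ^ q ≡ x
    fermat = *-cancelʳ-nonzero (Π-nonzero q (φ ∘ fromF) (λ i → φ-nonzero (fromF i))) x^q*P≡x*P

  fermat : ∀ x → x ^ q ≡ x
  fermat x with x ≟ 0#
  ... | no nx = Fermat.fermat x nx
  ... | yes refl = lem q (proj₂ q≡2+)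
    where
    lem : ∀ n {q'} → n ≡ suc (suc q') → 0# ^ n ≡ 0#
    lem (suc n) refl = zeroˡ _

module VanishingPolynomial {q : ℕ} (𝔽 : FiniteField q) where

  open FermatsLittleTheorem 𝔽 public
  open import Data.Fin using (Fin; zero; suc)
  import Data.Fin.Properties as FP

  ev-z-minus : ∀ b x → ev (z-minus b) x ≡ x + - b
  ev-z-minus b x = trans (cong (λ v → - b + x * (1# + v)) (zeroʳ x))
    (trans (cong (λ v → - b + x * v) (+-identityʳ 1#)) (trans (cong (- b +_) (*-identityʳ x)) (+-comm _ _)))

  ev-z-minus-nonzero : ∀ b x → ¬ x ≡ b → ¬ ev (z-minus b) x ≡ 0#
  ev-z-minus-nonzero b x ne e = ne (sub0⇒≡ x b (trans (sym (ev-z-minus b x)) e))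

  ∏-z-minus : ∀ n → (Fin n → Carrier) → Poly
  ∏-z-minus zero g = 1ₚ
  ∏-z-minus (suc n) g = z-minus (g zero) *ₚ ∏-z-minus n (g ∘ suc)

  split-off-root : ∀ n (g : Fin (suc n) → Carrier) → (∀ i j → g i ≡ g j → i ≡ j) → ∀ S → (∀ i → ev S (g i) ≡ 0#) →
          Σ Poly (λ S₁ → (S ≋ z-minus (g zero) *ₚ S₁) × (∀ i → ev S₁ (g (suc i)) ≡ 0#))
  split-off-root n g inj S h with factor S (g zero)
  ... | S₁ , eS = S₁ , eS' , h₁
    where
    b : Carrier
    b = g zero
    eS' : S ≋ z-minus b *ₚ S₁
    eS' = ≋-trans eS (≋-trans (+-congˡ (z-minus b *ₚ S₁) ⟨ (λ { zero → h zero ; (suc j) → refl }) ⟩) (+ₚ-identityʳ _))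
    h₁ : ∀ i → ev S₁ (g (suc i)) ≡ 0#
    h₁ i with ev S₁ (g (suc i)) ≟ 0#
    ... | yes e = e
    ... | no ne = ⊥-elim (*-nonzero (ev-z-minus-nonzero b (g (suc i)) (λ e → FP.0≢1+n (sym (inj (suc i) zero e)))) ne
                    (trans (sym (ev-* (z-minus b) S₁ (g (suc i)))) (trans (sym (ev-cong S _ (g (suc i)) eS')) (h (suc i)))))

  distinct-roots-divide : ∀ n (g : Fin n → Carrier) → (∀ i j → g i ≡ g j → i ≡ j) → ∀ S → (∀ i → ev S (g i) ≡ 0#) →
          Σ Poly (λ T → S ≋ ∏-z-minus n g *ₚ T)
  distinct-roots-divide zero g inj S h = S , ≋-sym (*-identityˡₚ S)
  distinct-roots-divide (suc n) g inj S h with split-off-root n g inj S h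
  ... | S₁ , eS' , h₁ with distinct-roots-divide n (g ∘ suc) (λ i j e → FP.suc-injective (inj (suc i) (suc j) e)) S₁ h₁
  ...   | T , eT = T , ≋-trans eS' (≋-trans (*-congˡ (z-minus (g zero)) eT) (≋-sym (*ₚ-assoc (z-minus (g zero)) (∏-z-minus n (g ∘ suc)) T)))

  monic-* : ∀ {p r a b} → Monic p a → Monic r b → Monic (p *ₚ r) (a ℕ.+ b)
  monic-* {p} {r} (hp , lp) (hr , lr) = HasDeg-* {p} {r} hp hr , trans (lc-* {p} {r} hp hr) (trans (cong₂ _*_ lp lr) (*-identityʳ 1#))

  monic-z-minus : ∀ b → Monic (z-minus b) 1
  monic-z-minus b = (1≢0 , λ { zero () ; (suc zero) (s≤s ()) ; (suc (suc j)) _ → refl }) , refl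

  monic-∏-z-minus : ∀ n g → Monic (∏-z-minus n g) n
  monic-∏-z-minus zero g = (1≢0 , λ { zero () ; (suc j) _ → refl }) , refl
  monic-∏-z-minus (suc n) g = monic-* {z-minus (g zero)} {∏-z-minus n (g ∘ suc)} (monic-z-minus (g zero)) (monic-∏-z-minus n (g ∘ suc))

  fromF-inj : ∀ i j → fromF i ≡ fromF j → i ≡ j
  fromF-inj i j e = trans (sym (to-from i)) (trans (cong toF e) (to-from j))

  vanishing⇒≋0⊎deg≥q : ∀ S → (∀ x → ev S x ≡ 0#) → S ≋ [] ⊎ Σ ℕ (λ d → HasDeg S d × q ≤ d)
  vanishing⇒≋0⊎deg≥q S h with distinct-roots-divide q fromF fromF-inj S (λ i → h (fromF i))
  ... | T , eT with degView T
  ...   | inj₁ z = inj₁ (≋-trans eT (≋-trans (*-congˡ (∏-z-minus q fromF) z) (*-zeroʳ (∏-z-minus q fromF))))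
  ...   | inj₂ (e , de) = inj₂ (q ℕ.+ e , HasDeg-cong {∏-z-minus q fromF *ₚ T} (≋-sym eT) (HasDeg-* {∏-z-minus q fromF} {T} (proj₁ (monic-∏-z-minus q fromF)) de) , NP.m≤m+n q e)

  DegLt-q-vanishing⇒≋0 : ∀ S → DegLt S q → (∀ x → ev S x ≡ 0#) → S ≋ []
  DegLt-q-vanishing⇒≋0 S b h with vanishing⇒≋0⊎deg≥q S h
  ... | inj₁ z = z
  ... | inj₂ (d , (nz , _) , le) = ⊥-elim (nz (b d le))

  zₚ : Poly
  zₚ = 0# ∷ 1# ∷ []

  zₚ-* : ∀ X → zₚ *ₚ X ≋ 0# ∷ X
  zₚ-* X = +-cong (0·≋ X) (∷-cong refl (≋-trans ([c]* 1# X) (1·≋ X)))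

  zₚ^ : ∀ n → zₚ ^ₚ n ≋ shift n 1ₚ
  zₚ^ zero = ≋-refl
  zₚ^ (suc n) = ≋-trans (zₚ-* (zₚ ^ₚ n)) (∷-cong refl (zₚ^ n))

  coeff-shift1 : ∀ k → coeff (shift k 1ₚ) k ≡ 1#
  coeff-shift1 zero = refl
  coeff-shift1 (suc k) = coeff-shift1 k

  DegLe-shift1 : ∀ k → DegLe (shift k 1ₚ) k
  DegLe-shift1 zero (suc j) _ = refl
  DegLe-shift1 (suc k) (suc j) (s≤s lt) = DegLe-shift1 k j lt

  2≤q : 2 ≤ q
  2≤q with q≡2+
  ... | q' , e = subst (2 ≤_) (sym e) (s≤s (s≤s z≤n))

  ev-zₚ : ∀ x → ev zₚ x ≡ x
  ev-zₚ x = trans (+-identityˡ _) (trans (cong (λ v → x * (1# + v)) (zeroʳ x)) (trans (cong (x *_) (+-identityʳ 1#)) (*-identityʳ x)))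

  ev-lin : ∀ b d x → ev (lin b d) x ≡ b + x * d
  ev-lin b d x = cong (λ v → b + x * v) (trans (cong (d +_) (zeroʳ x)) (+-identityʳ d))

  z^q-z : Poly
  z^q-z = zₚ ^ₚ q -ₚ zₚ

  coeff-z^q-z : ∀ j → coeff z^q-z j ≡ coeff (shift q 1ₚ) j + - coeff zₚ j
  coeff-z^q-z j = trans (coeff-+ (zₚ ^ₚ q) (negₚ zₚ) j) (cong₂ _+_ (at (zₚ^ q) j) (coeff-neg zₚ j))

  coeff-zₚ-hi : ∀ j → 2 ≤ j → coeff zₚ j ≡ 0#
  coeff-zₚ-hi (suc (suc j)) _ = refl
  coeff-zₚ-hi (suc zero) (s≤s ())

  HasDeg-z^q-z : HasDeg z^q-z q
  HasDeg-z^q-z = (λ e → 1≢0 (trans (sym top) e)) , λ j lt →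
    trans (coeff-z^q-z j) (trans (cong₂ (λ u v → u + - v) (DegLe-shift1 q j lt) (coeff-zₚ-hi j (NP.≤-trans 2≤q (NP.<⇒≤ lt))))
      (trans (cong (0# +_) -0≡0) (+-identityʳ _)))
    where
    top : coeff z^q-z q ≡ 1#
    top = trans (coeff-z^q-z q) (trans (cong₂ (λ u v → u + - v) (coeff-shift1 q) (coeff-zₚ-hi q 2≤q))
      (trans (cong (1# +_) -0≡0) (+-identityʳ _)))

  ev-z^q-z : ∀ x → ev z^q-z x ≡ 0#
  ev-z^q-z x = trans (ev-+ (zₚ ^ₚ q) (negₚ zₚ) x) (trans (cong₂ _+_ (trans (ev-^ zₚ q x) (trans (cong (_^ q) (ev-zₚ x)) (fermat x)))
    (trans (ev-neg zₚ x) (cong -_ (ev-zₚ x)))) (-‿inverseʳ x))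

  module FrobeniusDifference (b d : Carrier) where

    L R : Poly
    L = lin b d
    R = constₚ b +ₚ d ·ₚ (zₚ ^ₚ q)
    1≤q : 1 ≤ q
    1≤q = NP.≤-trans (s≤s z≤n) 2≤q
    L^q≤q : DegLe (L ^ₚ q) (q ℕ.* 1) × coeff (L ^ₚ q) (q ℕ.* 1) ≡ d ^ q
    L^q≤q = DegLe-^ L 1 (DegLe-lin b d) q
    coeff-difference : ∀ j → coeff (L ^ₚ q -ₚ R) j ≡ coeff (L ^ₚ q) j + - (coeff (constₚ b) j + d * coeff (shift q 1ₚ) j)
    coeff-difference j = trans (coeff-+ (L ^ₚ q) (negₚ R) j) (cong (coeff (L ^ₚ q) j +_) (trans (coeff-neg R j)
      (cong -_ (trans (coeff-+ (constₚ b) (d ·ₚ (zₚ ^ₚ q)) j)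
        (cong (coeff (constₚ b) j +_) (trans (coeff-· d (zₚ ^ₚ q) j) (cong (d *_) (at (zₚ^ q) j))))))))
    difference-DegLt : DegLt (L ^ₚ q -ₚ R) q
    difference-DegLt j q≤j with NP.m≤n⇒m<n∨m≡n q≤j
    ... | inj₂ refl = begin
      coeff (L ^ₚ q -ₚ R) q                                      ≡⟨ coeff-difference q ⟩
      coeff (L ^ₚ q) q + - (coeff (constₚ b) q + d * coeff (shift q 1ₚ) q)
        ≡⟨ cong (λ v → coeff (L ^ₚ q) q + - (v + d * coeff (shift q 1ₚ) q)) (coeff-constₚ b q 1≤q) ⟩
      coeff (L ^ₚ q) q + - (0# + d * coeff (shift q 1ₚ) q)
        ≡⟨ cong₂ (λ u v → u + - (0# + d * v))
             (trans (cong (coeff (L ^ₚ q)) (sym (NP.*-identityʳ q))) (trans (proj₂ L^q≤q) (fermat d)))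
             (coeff-shift1 q) ⟩
      d + - (0# + d * 1#)                                        ≡⟨ cong (λ v → d + - v) (trans (+-identityˡ _) (*-identityʳ d)) ⟩
      d + - d                                                    ≡⟨ -‿inverseʳ d ⟩
      0#                                                         ∎
      where open ≡-Reasoning
    ... | inj₁ q<j = begin
      coeff (L ^ₚ q -ₚ R) j                                      ≡⟨ coeff-difference j ⟩
      coeff (L ^ₚ q) j + - (coeff (constₚ b) j + d * coeff (shift q 1ₚ) j)
        ≡⟨ cong (λ v → coeff (L ^ₚ q) j + - (v + d * coeff (shift q 1ₚ) j)) (coeff-constₚ b j (NP.≤-trans 1≤q q≤j)) ⟩
      coeff (L ^ₚ q) j + - (0# + d * coeff (shift q 1ₚ) j)
        ≡⟨ cong₂ (λ u v → u + - (0# + d * v))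
             (proj₁ L^q≤q j (subst (_< j) (sym (NP.*-identityʳ q)) q<j)) (DegLe-shift1 q j q<j) ⟩
      0# + - (0# + d * 0#)                                       ≡⟨ cong (λ v → 0# + - v) (trans (+-identityˡ _) (zeroʳ d)) ⟩
      0# + - 0#                                                  ≡⟨ trans (+-identityˡ _) -0≡0 ⟩
      0#                                                         ∎
      where open ≡-Reasoning
    difference-vanishes : ∀ x → ev (L ^ₚ q -ₚ R) x ≡ 0#
    difference-vanishes x = begin
      ev (L ^ₚ q -ₚ R) x                     ≡⟨ ev-+ (L ^ₚ q) (negₚ R) x ⟩
      ev (L ^ₚ q) x + ev (negₚ R) x          ≡⟨ cong₂ _+_ (ev-^ L q x) (ev-neg R x) ⟩
      ev L x ^ q + - ev R x                  ≡⟨ cong₂ (λ u v → u + - v) (trans (fermat (ev L x)) (ev-lin b d x)) ev-R ⟩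
      (b + x * d) + - (b + d * x)            ≡⟨ cong (λ v → (b + x * d) + - (b + v)) (*-comm d x) ⟩
      (b + x * d) + - (b + x * d)            ≡⟨ -‿inverseʳ _ ⟩
      0#                                     ∎
      where
      open ≡-Reasoning
      ev-R : ev R x ≡ b + d * x
      ev-R = trans (ev-+ (constₚ b) (d ·ₚ (zₚ ^ₚ q)) x) (cong₂ _+_ (trans (cong (b +_) (zeroʳ x)) (+-identityʳ b))
        (trans (ev-· d (zₚ ^ₚ q) x) (cong (d *_) (trans (ev-^ zₚ q x) (trans (cong (_^ q) (ev-zₚ x)) (fermat x))))))

  -- (b + dz)^q − (b + dz^q) has no z^q-term since d^q = d, and vanishes on 𝔽; so it is 0.
  frobenius-lin : ∀ b d → lin b d ^ₚ q ≋ constₚ b +ₚ d ·ₚ (zₚ ^ₚ q)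
  frobenius-lin b d = PGP.x∙y⁻¹≈ε⇒x≈y (L ^ₚ q) R (DegLt-q-vanishing⇒≋0 (L ^ₚ q -ₚ R) difference-DegLt difference-vanishes)
    where open FrobeniusDifference b d

module Homogenisation {q : ℕ} (𝔽 : FiniteField q) where

  open VanishingPolynomial 𝔽 public

  Σ-cong : ∀ n (f g : ℕ → Poly) → (∀ j → f j ≋ g j) → Σₚ n f ≋ Σₚ n g
  Σ-cong zero f g h = ≋-refl
  Σ-cong (suc n) f g h = +-cong (Σ-cong n f g h) (h n)

  Σ-+ : ∀ n (f g : ℕ → Poly) → Σₚ n (λ j → f j +ₚ g j) ≋ Σₚ n f +ₚ Σₚ n g
  Σ-+ zero f g = ≋-refl
  Σ-+ (suc n) f g = ≋-trans (+-congʳ (f n +ₚ g n) (Σ-+ n f g))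
    (PS.solve 4 (λ a b c d → (a ⊞ b) ⊞ (c ⊞ d) ≐ (a ⊞ c) ⊞ (b ⊞ d)) ≋-refl (Σₚ n f) (Σₚ n g) (f n) (g n))

  Σ-front : ∀ n (f : ℕ → Poly) → Σₚ (suc n) f ≋ f 0 +ₚ Σₚ n (f ∘ suc)
  Σ-front zero f = ≋-sym (+ₚ-identityʳ (f 0))
  Σ-front (suc n) f = ≋-trans (+-congʳ (f (suc n)) (Σ-front n f)) (+ₚ-assoc (f 0) (Σₚ n (f ∘ suc)) (f (suc n)))

  Σ-* : ∀ n X (f : ℕ → Poly) → Σₚ n (λ j → X *ₚ f j) ≋ X *ₚ Σₚ n f
  Σ-* zero X f = ≋-sym (*-zeroʳ X)
  Σ-* (suc n) X f = ≋-trans (+-congʳ (X *ₚ f n) (Σ-* n X f)) (≋-sym (*-distribˡ X (Σₚ n f) (f n)))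

  Σ-0 : ∀ n (f : ℕ → Poly) → (∀ j → f j ≋ []) → Σₚ n f ≋ []
  Σ-0 zero f h = ≋-refl
  Σ-0 (suc n) f h = +-cong (Σ-0 n f h) (h n)

  ·-distribʳ : ∀ a b X → (a + b) ·ₚ X ≋ a ·ₚ X +ₚ b ·ₚ X
  ·-distribʳ a b X = ⟨ (λ j → trans (coeff-· (a + b) X j) (trans (distribʳ _ _ _) (sym (trans (coeff-+ (a ·ₚ X) (b ·ₚ X) j) (cong₂ _+_ (coeff-· a X j) (coeff-· b X j)))))) ⟩

  ·-via-* : ∀ c X → c ·ₚ X ≋ (c ∷ []) *ₚ X
  ·-via-* c X = ≋-sym ([c]* c X)

  DegLe-+ : ∀ p r N → DegLe p N → DegLe r N → DegLe (p +ₚ r) N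
  DegLe-+ p r N hp hr j lt = trans (coeff-+ p r j) (trans (cong₂ _+_ (hp j lt) (hr j lt)) (+-identityˡ _))

  DegLe-· : ∀ c p N → DegLe p N → DegLe (c ·ₚ p) N
  DegLe-· c p N h j lt = trans (coeff-· c p j) (trans (cong (c *_) (h j lt)) (zeroʳ c))

  DegLe-Σ : ∀ n (f : ℕ → Poly) N → (∀ j → j < n → DegLe (f j) N) → DegLe (Σₚ n f) N
  DegLe-Σ zero f N h j lt = refl
  DegLe-Σ (suc n) f N h = DegLe-+ (Σₚ n f) (f n) N (DegLe-Σ n f N (λ j lt → h j (NP.m≤n⇒m≤1+n lt))) (h n NP.≤-refl)

  DegLe-hom : ∀ p N u w → DegLe u 1 → DegLe w 1 → DegLe (homog p N u w) N
  DegLe-hom p N u w hu hw = DegLe-Σ (suc N) (λ j → coeff p j ·ₚ (u ^ₚ j *ₚ w ^ₚ (N ∸ j))) N (λ j lt → DegLe-· (coeff p j) (u ^ₚ j *ₚ w ^ₚ (N ∸ j)) N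
    (subst (DegLe (u ^ₚ j *ₚ w ^ₚ (N ∸ j))) (trans (cong₂ ℕ._+_ (NP.*-identityʳ j) (NP.*-identityʳ (N ∸ j))) (NP.m+[n∸m]≡n (NP.≤-pred lt)))
      (DegLe-* (u ^ₚ j) (w ^ₚ (N ∸ j)) (j ℕ.* 1) ((N ∸ j) ℕ.* 1) (proj₁ (DegLe-^ u 1 hu j)) (proj₁ (DegLe-^ w 1 hw (N ∸ j))))))

  module Homogeneous (u w : Poly) where

    hom : Poly → ℕ → Poly
    hom p N = homog p N u w

    hom-cong : ∀ {p p'} N → p ≋ p' → hom p N ≋ hom p' N
    hom-cong N h = Σ-cong (suc N) _ _ (λ j → ·-cong (at h j) ≋-refl)

    hom-+ : ∀ p r N → hom (p +ₚ r) N ≋ hom p N +ₚ hom r N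
    hom-+ p r N = ≋-trans (Σ-cong (suc N) _ _ (λ j → ≋-trans (·-cong (coeff-+ p r j) ≋-refl) (·-distribʳ _ _ _)))
      (Σ-+ (suc N) _ _)

    hom-· : ∀ c p N → hom (c ·ₚ p) N ≋ c ·ₚ hom p N
    hom-· c p N = ≋-trans (Σ-cong (suc N) _ _ (λ j → ≋-trans (·-cong (coeff-· c p j) ≋-refl)
         (≋-trans (≋-sym (·-assoc c (coeff p j) _)) (·-via-* c _))))
      (≋-trans (Σ-* (suc N) (c ∷ []) _) (≋-sym (·-via-* c _)))

    hom-[] : ∀ N → hom [] N ≋ []
    hom-[] N = Σ-0 (suc N) _ (λ j → 0·≋ _)

    hom-0 : ∀ p → hom p 0 ≋ (coeff p 0 ∷ [])
    hom-0 p = ≋-trans (·-cong refl (*-identityˡₚ 1ₚ)) ⟨ (λ { zero → *-identityʳ _ ; (suc j) → refl }) ⟩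

    hom-∷ : ∀ a p N → hom (a ∷ p) (suc N) ≋ a ·ₚ w ^ₚ suc N +ₚ u *ₚ hom p N
    hom-∷ a p N = ≋-trans (Σ-front (suc N) _) (+-cong (·-cong refl (*-identityˡₚ _))
      (≋-trans (Σ-cong (suc N) _ _ (λ j → ≋-trans (·-cong refl (*ₚ-assoc u (u ^ₚ j) (w ^ₚ (N ∸ j)))) (≋-sym (·-*ʳ (coeff p j) u _))))
        (Σ-* (suc N) u _)))

    DegLe-tail : ∀ a p N → DegLe (a ∷ p) (suc N) → DegLe p N
    DegLe-tail a p N h j lt = h (suc j) (s≤s lt)

    DegLe0-tail : ∀ a p → DegLe (a ∷ p) 0 → p ≋ []
    DegLe0-tail a p h = ⟨ (λ j → h (suc j) (s≤s z≤n)) ⟩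

    hom-pad : ∀ p N k → DegLe p N → hom p (N ℕ.+ k) ≋ hom p N *ₚ w ^ₚ k
    hom-pad [] N k h = ≋-trans (hom-[] (N ℕ.+ k)) (≋-sym (*-congʳ (w ^ₚ k) (hom-[] N)))
    hom-pad (a ∷ p) zero zero h = ≋-sym (*-identityʳₚ _)
    hom-pad (a ∷ p) zero (suc k) h = begin
      hom (a ∷ p) (suc k) ≈⟨ hom-∷ a p k ⟩
      a ·ₚ w ^ₚ suc k +ₚ u *ₚ hom p k ≈⟨ +-congˡ (a ·ₚ w ^ₚ suc k) (≋-trans (*-congˡ u (≋-trans (hom-cong k (DegLe0-tail a p h)) (hom-[] k))) (*-zeroʳ u)) ⟩
      a ·ₚ w ^ₚ suc k +ₚ [] ≈⟨ +ₚ-identityʳ _ ⟩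
      a ·ₚ w ^ₚ suc k ≈⟨ ·-via-* a _ ⟩
      (a ∷ []) *ₚ w ^ₚ suc k ≈⟨ *-congʳ (w ^ₚ suc k) (≋-sym (hom-0 (a ∷ p))) ⟩
      hom (a ∷ p) 0 *ₚ w ^ₚ suc k ∎
      where open ≋R
    hom-pad (a ∷ p) (suc N) k h = begin
      hom (a ∷ p) (suc (N ℕ.+ k)) ≈⟨ hom-∷ a p (N ℕ.+ k) ⟩
      a ·ₚ w ^ₚ (suc N ℕ.+ k) +ₚ u *ₚ hom p (N ℕ.+ k) ≈⟨ +-cong (≋-trans (·-cong refl (pow-+ w (suc N) k)) (·-via-* a _)) (*-congˡ u (hom-pad p N k (DegLe-tail a p N h))) ⟩
      (a ∷ []) *ₚ (w ^ₚ suc N *ₚ w ^ₚ k) +ₚ u *ₚ (hom p N *ₚ w ^ₚ k)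
        ≈⟨ PS.solve 5 (λ A W K U H → A ⊠ (W ⊠ K) ⊞ U ⊠ (H ⊠ K) ≐ (A ⊠ W ⊞ U ⊠ H) ⊠ K) ≋-refl (a ∷ []) (w ^ₚ suc N) (w ^ₚ k) u (hom p N) ⟩
      ((a ∷ []) *ₚ w ^ₚ suc N +ₚ u *ₚ hom p N) *ₚ w ^ₚ k ≈⟨ *-congʳ (w ^ₚ k) (+-congʳ (u *ₚ hom p N) (≋-sym (·-via-* a (w ^ₚ suc N)))) ⟩
      (a ·ₚ w ^ₚ suc N +ₚ u *ₚ hom p N) *ₚ w ^ₚ k ≈⟨ *-congʳ (w ^ₚ k) (≋-sym (hom-∷ a p N)) ⟩
      hom (a ∷ p) (suc N) *ₚ w ^ₚ k ∎
      where open ≋R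

    hom-* : ∀ p r N M → DegLe p N → DegLe r M → hom (p *ₚ r) (N ℕ.+ M) ≋ hom p N *ₚ hom r M
    hom-* [] r N M hp hr = ≋-trans (hom-[] (N ℕ.+ M)) (≋-sym (*-congʳ (hom r M) (hom-[] N)))
    hom-* (a ∷ p) r zero M hp hr = begin
      hom ((a ∷ p) *ₚ r) M ≈⟨ hom-cong M e1 ⟩
      hom (a ·ₚ r) M ≈⟨ hom-· a r M ⟩
      a ·ₚ hom r M ≈⟨ ·-via-* a _ ⟩
      (a ∷ []) *ₚ hom r M ≈⟨ *-congʳ (hom r M) (≋-sym (hom-0 (a ∷ p))) ⟩
      hom (a ∷ p) 0 *ₚ hom r M ∎
      where
      open ≋R
      e1 : (a ∷ p) *ₚ r ≋ a ·ₚ r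
      e1 = ≋-trans (+-congˡ (a ·ₚ r) (≋-trans (∷-cong refl (*-congʳ r (DegLe0-tail a p hp))) ⟨ (λ { zero → refl ; (suc j) → refl }) ⟩)) (+ₚ-identityʳ _)
    hom-* (a ∷ p) r (suc N) M hp hr = begin
      hom (a ·ₚ r +ₚ (0# ∷ (p *ₚ r))) (suc (N ℕ.+ M)) ≈⟨ hom-+ (a ·ₚ r) (0# ∷ (p *ₚ r)) (suc (N ℕ.+ M)) ⟩
      hom (a ·ₚ r) (suc (N ℕ.+ M)) +ₚ hom (0# ∷ (p *ₚ r)) (suc (N ℕ.+ M)) ≈⟨ +-cong e1 e2 ⟩
      (a ∷ []) *ₚ (hom r M *ₚ w ^ₚ suc N) +ₚ u *ₚ (hom p N *ₚ hom r M)
        ≈⟨ PS.solve 5 (λ A R W U H → A ⊠ (R ⊠ W) ⊞ U ⊠ (H ⊠ R) ≐ (A ⊠ W ⊞ U ⊠ H) ⊠ R) ≋-refl (a ∷ []) (hom r M) (w ^ₚ suc N) u (hom p N) ⟩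
      ((a ∷ []) *ₚ w ^ₚ suc N +ₚ u *ₚ hom p N) *ₚ hom r M ≈⟨ *-congʳ (hom r M) (+-congʳ (u *ₚ hom p N) (≋-sym (·-via-* a (w ^ₚ suc N)))) ⟩
      (a ·ₚ w ^ₚ suc N +ₚ u *ₚ hom p N) *ₚ hom r M ≈⟨ *-congʳ (hom r M) (≋-sym (hom-∷ a p N)) ⟩
      hom (a ∷ p) (suc N) *ₚ hom r M ∎
      where
      open ≋R
      e1 : hom (a ·ₚ r) (suc (N ℕ.+ M)) ≋ (a ∷ []) *ₚ (hom r M *ₚ w ^ₚ suc N)
      e1 = ≋-trans (hom-· a r (suc (N ℕ.+ M))) (≋-trans (·-via-* a (hom r (suc (N ℕ.+ M)))) (*-congˡ (a ∷ [])
             (≋-trans (≡⇒≋ (cong (hom r) (NP.+-comm (suc N) M))) (hom-pad r M (suc N) hr))))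
      e2 : hom (0# ∷ (p *ₚ r)) (suc (N ℕ.+ M)) ≋ u *ₚ (hom p N *ₚ hom r M)
      e2 = ≋-trans (hom-∷ 0# (p *ₚ r) (N ℕ.+ M)) (+-cong (0·≋ _) (*-congˡ u (hom-* p r N M (DegLe-tail a p N hp) hr)))

    hom-^ : ∀ p N → DegLe p N → ∀ k → hom (p ^ₚ k) (k ℕ.* N) ≋ hom p N ^ₚ k
    hom-^ p N h zero = hom-0 1ₚ
    hom-^ p N h (suc k) = ≋-trans (hom-* p (p ^ₚ k) N (k ℕ.* N) h (proj₁ (DegLe-^ p N h k))) (*-congˡ (hom p N) (hom-^ p N h k))

    hom-neg : ∀ p N → hom (negₚ p) N ≋ negₚ (hom p N)
    hom-neg p N = ≋-trans (hom-cong N (e p)) (≋-trans (hom-· (- 1#) p N) (≋-sym (e (hom p N))))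
      where
      e : ∀ X → negₚ X ≋ (- 1#) ·ₚ X
      e X = ⟨ (λ j → trans (coeff-neg X j) (sym (trans (coeff-· (- 1#) X j) (FRP.-1*x≈-x _)))) ⟩

    hom-zₚ : hom zₚ 1 ≋ u
    hom-zₚ = ≋-trans (hom-∷ 0# (1# ∷ []) 0) (≋-trans (+-cong (0·≋ _) (*-congˡ u (hom-0 (1# ∷ [])))) (*-identityʳₚ u))

    hom-z^q-z-w : hom z^q-z q *ₚ w ≋ u ^ₚ q *ₚ w -ₚ u *ₚ w ^ₚ q
    hom-z^q-z-w = begin
      hom z^q-z q *ₚ w ≈⟨ *-congʳ w (≋-trans (hom-+ (zₚ ^ₚ q) (negₚ zₚ) q) (+-cong e1 (≋-trans (hom-neg zₚ q) (neg-cong e2)))) ⟩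
      (u ^ₚ q -ₚ u *ₚ w ^ₚ (q ∸ 1)) *ₚ w ≈⟨ PRP.[y-z]x≈yx-zx w (u ^ₚ q) (u *ₚ w ^ₚ (q ∸ 1)) ⟩
      u ^ₚ q *ₚ w -ₚ (u *ₚ w ^ₚ (q ∸ 1)) *ₚ w ≈⟨ +-congˡ (u ^ₚ q *ₚ w) (neg-cong e3) ⟩
      u ^ₚ q *ₚ w -ₚ u *ₚ w ^ₚ q ∎
      where
      open ≋R
      q1 : 1 ℕ.+ (q ∸ 1) ≡ q
      q1 = NP.m+[n∸m]≡n (NP.≤-trans (s≤s z≤n) 2≤q)
      e1 : hom (zₚ ^ₚ q) q ≋ u ^ₚ q
      e1 = ≋-trans (≡⇒≋ (cong (hom (zₚ ^ₚ q)) (sym (NP.*-identityʳ q)))) (≋-trans (hom-^ zₚ 1 (DegLe-lin 0# 1#) q) (^-cong q hom-zₚ))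
      e2 : hom zₚ q ≋ u *ₚ w ^ₚ (q ∸ 1)
      e2 = ≋-trans (≡⇒≋ (cong (hom zₚ) (sym q1))) (≋-trans (hom-pad zₚ 1 (q ∸ 1) (DegLe-lin 0# 1#)) (*-congʳ (w ^ₚ (q ∸ 1)) hom-zₚ))
      e3 : (u *ₚ w ^ₚ (q ∸ 1)) *ₚ w ≋ u *ₚ w ^ₚ q
      e3 = ≋-trans (*ₚ-assoc u (w ^ₚ (q ∸ 1)) w) (*-congˡ u (≋-trans (*ₚ-comm (w ^ₚ (q ∸ 1)) w)
             (≡⇒≋ (cong (w ^ₚ_) q1))))

  +≈+⇒-≈- : ∀ A B C D → A +ₚ D ≋ C +ₚ B → A -ₚ B ≋ C -ₚ D
  +≈+⇒-≈- A B C D A+D≈C+B = begin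
    A +ₚ negₚ B                     ≈⟨ ≋-sym (≋-trans (+-congˡ (A +ₚ negₚ B) (+ₚ-inverseʳ D)) (+ₚ-identityʳ _)) ⟩
    (A +ₚ negₚ B) +ₚ (D +ₚ negₚ D)  ≈⟨ PS.solve 4 (λ a nb d nd → (a ⊞ nb) ⊞ (d ⊞ nd) ≐ (a ⊞ d) ⊞ (nb ⊞ nd)) ≋-refl A (negₚ B) D (negₚ D) ⟩
    (A +ₚ D) +ₚ (negₚ B +ₚ negₚ D)  ≈⟨ +-congʳ (negₚ B +ₚ negₚ D) A+D≈C+B ⟩
    (C +ₚ B) +ₚ (negₚ B +ₚ negₚ D)  ≈⟨ PS.solve 4 (λ c b nb nd → (c ⊞ b) ⊞ (nb ⊞ nd) ≐ (c ⊞ nd) ⊞ (b ⊞ nb)) ≋-refl C B (negₚ B) (negₚ D) ⟩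
    (C +ₚ negₚ D) +ₚ (B +ₚ negₚ B)  ≈⟨ ≋-trans (+-congˡ (C +ₚ negₚ D) (+ₚ-inverseʳ B)) (+ₚ-identityʳ _) ⟩
    C +ₚ negₚ D                     ∎
    where open ≋R

  lin-split : ∀ x y → lin x y ≋ constₚ x +ₚ constₚ y *ₚ zₚ
  lin-split x y = ≋-sym (≋-trans (+-congˡ (constₚ x) ([c]* y zₚ)) ⟨ (λ { zero → trans (cong (x +_) (zeroʳ y)) (+-identityʳ x)
     ; (suc zero) → *-identityʳ y ; (suc (suc j)) → refl }) ⟩)

  frobenius-det : ∀ a b c d → lin b d ^ₚ q *ₚ lin a c -ₚ lin b d *ₚ lin a c ^ₚ q ≋ (a * d + - (b * c)) ·ₚ z^q-z
  frobenius-det a b c d = begin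
    u ^ₚ q *ₚ w -ₚ u *ₚ w ^ₚ q  ≈⟨ +≈+⇒-≈- (u ^ₚ q *ₚ w) (u *ₚ w ^ₚ q) (Δ *ₚ Y) (Δ *ₚ zₚ) cross-multiplied ⟩
    Δ *ₚ Y -ₚ Δ *ₚ zₚ           ≈⟨ ≋-sym (PRP.x[y-z]≈xy-xz Δ Y zₚ) ⟩
    Δ *ₚ z^q-z                  ≈⟨ ≋-sym (·-via-* (a * d + - (b * c)) z^q-z) ⟩
    (a * d + - (b * c)) ·ₚ z^q-z ∎
    where
    open ≋R
    u w Y Δ Ka Kb Kc Kd N common : Poly
    u = lin b d
    w = lin a c
    Y = zₚ ^ₚ q
    Δ = constₚ (a * d + - (b * c))
    Ka = constₚ a
    Kb = constₚ b
    Kc = constₚ c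
    Kd = constₚ d
    N = constₚ (- (b * c))
    common = Kb *ₚ Ka +ₚ Kd *ₚ Ka *ₚ Y +ₚ Kd *ₚ Kc *ₚ Y *ₚ zₚ +ₚ Ka *ₚ Kd *ₚ zₚ
    Δ≈ : Δ ≋ Ka *ₚ Kd +ₚ N
    Δ≈ = +-congʳ N (constₚ-* a d)
    bc+N≈0 : ∀ X → (Kb *ₚ Kc +ₚ N) *ₚ X ≋ []
    bc+N≈0 X = *-congʳ X (≋-trans (+-congʳ N (≋-sym (constₚ-* b c))) (+ₚ-inverseʳ (constₚ (b * c))))
    -- The semiring solver cannot cancel −bc against bc, so −bc is the opaque atom N, removed by bc+N≈0.
    cross-multiplied : u ^ₚ q *ₚ w +ₚ Δ *ₚ zₚ ≋ Δ *ₚ Y +ₚ u *ₚ w ^ₚ q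
    cross-multiplied = begin
      u ^ₚ q *ₚ w +ₚ Δ *ₚ zₚ
        ≈⟨ +-cong (*-cong (≋-trans (frobenius-lin b d) (+-congˡ Kb (·-via-* d Y))) (lin-split a c)) (*-congʳ zₚ Δ≈) ⟩
      (Kb +ₚ Kd *ₚ Y) *ₚ (Ka +ₚ Kc *ₚ zₚ) +ₚ (Ka *ₚ Kd +ₚ N) *ₚ zₚ
        ≈⟨ PS.solve 7 (λ ka kb kc kd n y z → (kb ⊞ kd ⊠ y) ⊠ (ka ⊞ kc ⊠ z) ⊞ (ka ⊠ kd ⊞ n) ⊠ z
             ≐ (kb ⊠ ka ⊞ kd ⊠ ka ⊠ y ⊞ kd ⊠ kc ⊠ y ⊠ z ⊞ ka ⊠ kd ⊠ z) ⊞ (kb ⊠ kc ⊞ n) ⊠ z) ≋-refl Ka Kb Kc Kd N Y zₚ ⟩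
      common +ₚ (Kb *ₚ Kc +ₚ N) *ₚ zₚ
        ≈⟨ ≋-trans (+-congˡ common (bc+N≈0 zₚ)) (≋-trans (+ₚ-identityʳ common) (≋-sym (≋-trans (+-congˡ common (bc+N≈0 Y)) (+ₚ-identityʳ common)))) ⟩
      common +ₚ (Kb *ₚ Kc +ₚ N) *ₚ Y
        ≈⟨ PS.solve 7 (λ ka kb kc kd n y z → (kb ⊠ ka ⊞ kd ⊠ ka ⊠ y ⊞ kd ⊠ kc ⊠ y ⊠ z ⊞ ka ⊠ kd ⊠ z) ⊞ (kb ⊠ kc ⊞ n) ⊠ y
             ≐ (ka ⊠ kd ⊞ n) ⊠ y ⊞ (kb ⊞ kd ⊠ z) ⊠ (ka ⊞ kc ⊠ y)) ≋-refl Ka Kb Kc Kd N Y zₚ ⟩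
      (Ka *ₚ Kd +ₚ N) *ₚ Y +ₚ (Kb +ₚ Kd *ₚ zₚ) *ₚ (Ka +ₚ Kc *ₚ Y)
        ≈⟨ +-cong (*-congʳ Y (≋-sym Δ≈)) (≋-sym (*-cong (lin-split b d) (≋-trans (frobenius-lin a c) (+-congˡ Ka (·-via-* c Y))))) ⟩
      Δ *ₚ Y +ₚ u *ₚ w ^ₚ q
        ∎

module Multiplicities {q : ℕ} (𝔽 : FiniteField q) where

  open Homogenisation 𝔽 public

  ∣ₚ⇒∣ : ∀ {p r} → p ∣ₚ r → p ∣ r
  ∣ₚ⇒∣ (s , e) = s , ⟨ e ⟩
  ∣⇒∣ₚ : ∀ {p r} → p ∣ r → p ∣ₚ r
  ∣⇒∣ₚ (s , e) = s , at e

  monicIrreducible⇒ : ∀ {p} → MonicIrreducible p → Σ ℕ (λ k → Monic p (suc k) × Irreducible p)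
  monicIrreducible⇒ (n , hd , lc , irr) = n , (hd , lc) , (λ r s e → irr r s (at e))

  ev-z-minus-self : ∀ b → ev (z-minus b) b ≡ 0#
  ev-z-minus-self b = trans (ev-z-minus b b) (-‿inverseʳ b)

  ev-∣ : ∀ b X → z-minus b ∣ X → ev X b ≡ 0#
  ev-∣ b X (s , e) = trans (ev-cong X _ b e) (trans (ev-* (z-minus b) s b) (trans (cong (_* ev s b) (ev-z-minus-self b)) (zeroˡ _)))

  z^q-z-nonzero : Nonzero z^q-z
  z^q-z-nonzero = HasDeg⇒nonzero {z^q-z} HasDeg-z^q-z

  -- R(b) ≠ 0, for otherwise R, of degree q − 1, would vanish on all of 𝔽.
  z^q-z-factor : ∀ b → Σ Poly (λ R → (z^q-z ≋ z-minus b *ₚ R) × ¬ ev R b ≡ 0#)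
  z^q-z-factor b with factor z^q-z b
  ... | R , eZ = R , eZ' , nzR
    where
    eZ' : z^q-z ≋ z-minus b *ₚ R
    eZ' = ≋-trans eZ (≋-trans (+-congˡ (z-minus b *ₚ R) ⟨ (λ { zero → ev-z^q-z b ; (suc j) → refl }) ⟩) (+ₚ-identityʳ _))
    nzR : ¬ ev R b ≡ 0#
    nzR e with vanishing⇒≋0⊎deg≥q R allv
      where
      allv : ∀ x → ev R x ≡ 0#
      allv x with x ≟ b
      ... | yes refl = e
      ... | no ne with ev R x ≟ 0#
      ...   | yes e' = e'
      ...   | no ne' = ⊥-elim (*-nonzero (ev-z-minus-nonzero b x ne) ne' (trans (sym (ev-* (z-minus b) R x)) (trans (sym (ev-cong z^q-z _ x eZ')) (ev-z^q-z x))))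
    ... | inj₁ z = z^q-z-nonzero (≋-trans eZ' (≋-trans (*-congˡ (z-minus b) z) (*-zeroʳ (z-minus b))))
    ... | inj₂ (dr , hr , le) = NP.<-irrefl refl (NP.≤-trans (s≤s le) (NP.≤-reflexive (sym qeq)))
      where
      qeq : q ≡ 1 ℕ.+ dr
      qeq = deg-* {z^q-z} {z-minus b} {R} eZ' HasDeg-z^q-z (proj₁ (monic-z-minus b)) hr

  z-minus-multiplicity : ∀ b m e → (z-minus b ^ₚ e) ∣ (z^q-z ^ₚ m) → e ≤ m
  z-minus-multiplicity b m e d with e NP.≤? m
  ... | yes le = le
  ... | no nle = ⊥-elim (^-nonzero m nzR (trans (sym (ev-^ R m b)) (ev-∣ b (R ^ₚ m) d3)))
    where
    R L : Poly
    R = proj₁ (z^q-z-factor b)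
    L = z-minus b
    eZ : z^q-z ≋ L *ₚ R
    eZ = proj₁ (proj₂ (z^q-z-factor b))
    nzR : ¬ ev R b ≡ 0#
    nzR = proj₂ (proj₂ (z^q-z-factor b))
    e'' : ℕ
    e'' = e ∸ suc m
    ee : m ℕ.+ suc e'' ≡ e
    ee = trans (NP.+-suc m e'') (NP.m+[n∸m]≡n (NP.≰⇒> nle))
    d1 : (L ^ₚ m *ₚ L ^ₚ suc e'') ∣ (L ^ₚ m *ₚ R ^ₚ m)
    d1 = ∣-cong (≋-trans (≡⇒≋ (cong (L ^ₚ_) (sym ee))) (pow-+ L m (suc e''))) (≋-trans (^-cong m eZ) (pow-* L R m)) d
    d2 : (L ^ₚ suc e'') ∣ (R ^ₚ m)
    d2 = ∣-cancel (nonzero-^ m (HasDeg⇒nonzero {L} (proj₁ (monic-z-minus b)))) d1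
    d3 : L ∣ (R ^ₚ m)
    d3 = ∣-trans (∣-* L (L ^ₚ e'')) d2

  NotLinear : Poly → Set
  NotLinear p = ∀ b → ¬ (p ≈ₚ lin (- b) 1#)

  monic-deg1⇒linear : ∀ {p} → Monic p 1 → p ≈ₚ lin (- (- coeff p 0)) 1#
  monic-deg1⇒linear {p} ((_ , hi) , lc) zero = sym (FGP.⁻¹-involutive _)
  monic-deg1⇒linear {p} ((_ , hi) , lc) (suc zero) = lc
  monic-deg1⇒linear {p} ((_ , hi) , lc) (suc (suc j)) = hi (suc (suc j)) (s≤s (s≤s z≤n))

  monic-deg≥2⇒NotLinear : ∀ {p k} → Monic p (suc (suc k)) → NotLinear p
  monic-deg≥2⇒NotLinear {p} {k} mp b e = 1≢0 (trans (sym (proj₂ mp)) (e (suc (suc k))))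

  factor-root : ∀ P x → ev P x ≡ 0# → Σ Poly (λ Q → P ≋ z-minus x *ₚ Q)
  factor-root P x e with factor P x
  ... | Q , eP = Q , ≋-trans eP (≋-trans (+-congˡ (z-minus x *ₚ Q) ⟨ (λ { zero → e ; (suc j) → refl }) ⟩) (+ₚ-identityʳ _))

  nonlinear-irreducible⇒no-root : ∀ {p k} → Monic p (suc k) → Irreducible p → NotLinear p → ∀ x → ¬ ev p x ≡ 0#
  nonlinear-irreducible⇒no-root {p} mp ip nl x e with factor-root p x e
  ... | Q , eP with ip (z-minus x) Q eP
  ...   | inj₁ c = IsConstant⇒¬HasDeg-suc {z-minus x} c (proj₁ (monic-z-minus x))
  ...   | inj₂ cQ = nl x (at (monic-associates-≋ {p} {z-minus x} mp (monic-z-minus x) eP cQ))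

  irreducible-∣-^ : ∀ {p k} → Monic p (suc k) → Irreducible p → ∀ A m → p ∣ (A ^ₚ m) → p ∣ A
  irreducible-∣-^ {p} {k} mp ip A zero (s , e) with degView s
  ... | inj₁ z = ⊥-elim (1≢0 (trans (at e 0) (trans (at (*-congˡ p z) 0) (at (*-zeroʳ p) 0))))
  ... | inj₂ (ds , hs) with deg-* {1ₚ} {p} {s} {0} e ((λ x → 1≢0 x) , (λ { zero () ; (suc j) _ → refl })) (proj₁ mp) hs
  ...   | ()
  irreducible-∣-^ {p} mp ip A (suc m) d with ∣? mp A
  ... | yes y = y
  ... | no na = irreducible-∣-^ mp ip A m (euclid mp ip A (A ^ₚ m) d na)

  nonlinear-∤-z^q-z : ∀ {p k} → Monic p (suc k) → Irreducible p → NotLinear p → ∀ m e → (p ^ₚ suc e) ∣ (z^q-z ^ₚ m) → ⊥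
  nonlinear-∤-z^q-z {p} {k} mp ip nl m e d with irreducible-∣-^ mp ip z^q-z m (∣-trans (∣-* p (p ^ₚ e)) d)
  ... | S , eS with vanishing⇒≋0⊎deg≥q S allS
    where
    allS : ∀ x → ev S x ≡ 0#
    allS x with ev S x ≟ 0#
    ... | yes y = y
    ... | no n = ⊥-elim (*-nonzero (nonlinear-irreducible⇒no-root mp ip nl x) n (trans (sym (ev-* p S x)) (trans (sym (ev-cong z^q-z _ x eS)) (ev-z^q-z x))))
  ...   | inj₁ z = z^q-z-nonzero (≋-trans eS (≋-trans (*-congˡ p z) (*-zeroʳ p)))
  ...   | inj₂ (ds , hs , le) = NP.<-irrefl refl (NP.≤-trans (s≤s (NP.m≤n+m ds k)) (NP.≤-trans (NP.≤-reflexive (sym qeq)) le))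
    where
    qeq : q ≡ suc k ℕ.+ ds
    qeq = deg-* {z^q-z} {p} {S} eS HasDeg-z^q-z (proj₁ mp) hs

module SymToH0 {q : ℕ} (𝔽 : FiniteField q) where

  open Multiplicities 𝔽 public
  open import Data.Vec as Vec using (Vec)
  open import Data.Fin using (toℕ)
  import Data.Vec.Properties as VP
  import Data.Integer as ℤ
  open ℤ using (+_)
  import Data.Integer.Properties as ZP

  toList-zipWith : ∀ {n} (α β : Vec Carrier n) → Vec.toList (Vec.zipWith _+_ α β) ≋ Vec.toList α +ₚ Vec.toList β
  toList-zipWith Vec.[] Vec.[] = ≋-refl
  toList-zipWith (a Vec.∷ α) (b Vec.∷ β) = ∷-cong refl (toList-zipWith α β)

  toList-injective : ∀ {n} (α β : Vec Carrier n) → Vec.toList α ≋ Vec.toList β → α ≡ β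
  toList-injective Vec.[] Vec.[] h = refl
  toList-injective (a Vec.∷ α) (b Vec.∷ β) ⟨ h ⟩ = cong₂ Vec._∷_ (h 0) (toList-injective α β ⟨ (h ∘ suc) ⟩)

  DegLe-toList : ∀ {n} (α : Vec Carrier (suc n)) → DegLe (Vec.toList α) n
  DegLe-toList {n} α j lt = coeff-len (Vec.toList α) j (subst (_≤ j) (sym (VP.length-toList α)) lt)

  HasDeg-toList : ∀ {n d} (α : Vec Carrier (suc n)) → HasDeg (Vec.toList α) d → d ≤ n
  HasDeg-toList {n} {d} α (lc≢0 , _) with d NP.≤? n
  ... | yes d≤n = d≤n
  ... | no d≰n = ⊥-elim (lc≢0 (DegLe-toList α d (NP.≰⇒> d≰n)))

  coeff-tabulate-< : ∀ k (f : ℕ → Carrier) i → i < k → coeff (Vec.toList (Vec.tabulate {k} (λ j → f (toℕ j)))) i ≡ f i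
  coeff-tabulate-< (suc k) f zero _ = refl
  coeff-tabulate-< (suc k) f (suc i) (s≤s lt) = coeff-tabulate-< k (f ∘ suc) i lt

  coeff-tabulate-≥ : ∀ k (f : ℕ → Carrier) i → k ≤ i → coeff (Vec.toList (Vec.tabulate {k} (λ j → f (toℕ j)))) i ≡ 0#
  coeff-tabulate-≥ zero f i _ = refl
  coeff-tabulate-≥ (suc k) f (suc i) (s≤s le) = coeff-tabulate-≥ k (f ∘ suc) i le

  tabulate-coeff : ∀ n P → DegLe P n → Vec.toList (Vec.tabulate {suc n} (λ j → coeff P (toℕ j))) ≋ P
  tabulate-coeff n P P≤n = ⟨ at-i ⟩
    where
    at-i : ∀ i → coeff (Vec.toList (Vec.tabulate {suc n} (λ j → coeff P (toℕ j)))) i ≡ coeff P i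
    at-i i with i NP.<? suc n
    ... | yes lt = coeff-tabulate-< (suc n) (coeff P) i lt
    ... | no nlt = trans (coeff-tabulate-≥ (suc n) (coeff P) i (NP.≮⇒≥ nlt)) (sym (P≤n i (NP.≮⇒≥ nlt)))

  +e′≡+e-m⇒e≡e′+m : ∀ e e′ m → + e′ ≡ + e ℤ.+ ℤ.- (+ m) → e ≡ e′ ℕ.+ m
  +e′≡+e-m⇒e≡e′+m e e′ m h = ZP.+-injective (sym (begin
    + e′ ℤ.+ + m                ≡⟨ cong (ℤ._+ + m) h ⟩
    (+ e ℤ.+ ℤ.- (+ m)) ℤ.+ + m  ≡⟨ ZP.+-assoc (+ e) (ℤ.- (+ m)) (+ m) ⟩
    + e ℤ.+ (ℤ.- (+ m) ℤ.+ + m)  ≡⟨ cong (λ x → + e ℤ.+ x) (ZP.+-inverseˡ (+ m)) ⟩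
    + e ℤ.+ + 0                 ≡⟨ ZP.+-identityʳ (+ e) ⟩
    + e                         ∎))
    where open ≡-Reasoning

  +e≡+[e+k]-k : ∀ e k → + e ≡ + (e ℕ.+ k) ℤ.+ ℤ.- (+ k)
  +e≡+[e+k]-k e k = sym (begin
    + (e ℕ.+ k) ℤ.+ ℤ.- (+ k)   ≡⟨ ZP.+-assoc (+ e) (+ k) (ℤ.- (+ k)) ⟩
    + e ℤ.+ (+ k ℤ.+ ℤ.- (+ k)) ≡⟨ cong (λ x → + e ℤ.+ x) (ZP.+-inverseʳ (+ k)) ⟩
    + e ℤ.+ + 0                ≡⟨ ZP.+-identityʳ (+ e) ⟩
    + e                        ∎)
    where open ≡-Reasoning

  ^-distrib-* : ∀ x y k → x ^ k * y ^ k ≡ (x * y) ^ k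
  ^-distrib-* x y zero = *-identityʳ 1#
  ^-distrib-* x y (suc k) = trans (FS.solve 4 (λ x y a b → (x :* a) :* (y :* b) := (x :* y) :* (a :* b)) refl x y (x ^ k) (y ^ k))
    (cong ((x * y) *_) (^-distrib-* x y k))

  1^n : ∀ k → 1# ^ k ≡ 1#
  1^n zero = refl
  1^n (suc k) = trans (*-identityˡ _) (1^n k)

  detPow-inverse : ∀ γ k → detPow γ (ℤ.- (+ k)) * det γ ^ k ≡ 1#
  detPow-inverse γ zero = *-identityʳ 1#
  detPow-inverse γ (suc k) = trans (^-distrib-* (inv (det γ) (GL2.det≢0 γ)) (det γ) (suc k))
    (trans (cong (_^ suc k) (inv-l (det γ) (GL2.det≢0 γ))) (1^n (suc k)))

  constₚ-^ : ∀ x k → constₚ x ^ₚ k ≋ constₚ (x ^ k)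
  constₚ-^ x zero = ≋-refl
  constₚ-^ x (suc k) = ≋-trans (*-congˡ (constₚ x) (constₚ-^ x k)) (≋-sym (constₚ-* x (x ^ k)))

  module Action (γ : GL2) where
    u w : Poly
    u = lin (GL2.b γ) (GL2.d γ)
    w = lin (GL2.a γ) (GL2.c γ)

    open Homogeneous u w public

    hom-z^q-z-semi-invariant : hom z^q-z q *ₚ w ≋ constₚ (det γ) *ₚ z^q-z
    hom-z^q-z-semi-invariant =
      ≋-trans hom-z^q-z-w (≋-trans (frobenius-det (GL2.a γ) (GL2.b γ) (GL2.c γ) (GL2.d γ)) (·-via-* (det γ) z^q-z))

    toList-symAct : ∀ t s (α : Sym t) → Vec.toList (symAct t s γ α) ≋ constₚ (detPow γ s) *ₚ hom (Vec.toList α) t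
    toList-symAct t s α =
      ≋-trans (tabulate-coeff t (c ·ₚ H) (DegLe-· c H t (DegLe-hom (Vec.toList α) t u w (DegLe-lin _ _) (DegLe-lin _ _))))
        (·-via-* c H)
      where
      c : Carrier
      c = detPow γ s
      H : Poly
      H = hom (Vec.toList α) t

    hom-toList : ∀ {t} (α : Sym t) → hom (Vec.toList α) (length (Vec.toList α)) ≋ hom (Vec.toList α) t *ₚ w
    hom-toList {t} α =
      ≋-trans (≡⇒≋ (cong (hom (Vec.toList α)) (trans (VP.length-toList α) (NP.+-comm 1 t))))
        (≋-trans (hom-pad (Vec.toList α) t 1 (DegLe-toList α)) (*-congˡ (hom (Vec.toList α) t) (*-identityʳₚ w)))

    hom-length : ∀ p d → HasDeg p d → hom p (length p) ≋ hom p d *ₚ w ^ₚ (length p ∸ d)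
    hom-length p d hp = ≋-trans (≡⇒≋ (cong (hom p) (sym (NP.m+[n∸m]≡n (HasDeg≤length {p} hp))))) (hom-pad p d _ (proj₂ hp))

    hom-z^q-z-^ : ∀ m → hom (z^q-z ^ₚ m) (m ℕ.* q) *ₚ w ^ₚ m ≋ constₚ (det γ ^ m) *ₚ z^q-z ^ₚ m
    hom-z^q-z-^ m = begin
      hom (z^q-z ^ₚ m) (m ℕ.* q) *ₚ w ^ₚ m ≈⟨ *-congʳ (w ^ₚ m) (hom-^ z^q-z q (proj₂ HasDeg-z^q-z) m) ⟩
      hom z^q-z q ^ₚ m *ₚ w ^ₚ m           ≈⟨ ≋-sym (pow-* (hom z^q-z q) w m) ⟩
      (hom z^q-z q *ₚ w) ^ₚ m              ≈⟨ ^-cong m hom-z^q-z-semi-invariant ⟩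
      (constₚ (det γ) *ₚ z^q-z) ^ₚ m       ≈⟨ pow-* (constₚ (det γ)) z^q-z m ⟩
      constₚ (det γ) ^ₚ m *ₚ z^q-z ^ₚ m     ≈⟨ *-congʳ (z^q-z ^ₚ m) (constₚ-^ (det γ) m) ⟩
      constₚ (det γ ^ m) *ₚ z^q-z ^ₚ m      ∎
      where open ≋R

  module Iso (m n t : ℕ) (t+n≡mq : t ℕ.+ n ≡ m ℕ.* q) where

    denom : Poly
    denom = z^q-z ^ₚ m

    HasDeg-denom : HasDeg denom (m ℕ.* q)
    HasDeg-denom = proj₁ (HasDeg-^ {z^q-z} {q} m HasDeg-z^q-z)

    denom-nonzero : Nonzero denom
    denom-nonzero = HasDeg⇒nonzero {denom} HasDeg-denom

    Φ : Sym t → RatFun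
    Φ α = Vec.toList α / denom

    Φ-+ : ∀ α β → Φ (Vec.zipWith _+_ α β) ≈ᵣ Φ α +ᵣ Φ β
    Φ-+ α β = at (≋-trans (*-congʳ (denom *ₚ denom) (toList-zipWith α β))
      (PS.solve 3 (λ a b d → (a ⊞ b) ⊠ (d ⊠ d) ≐ (a ⊠ d ⊞ b ⊠ d) ⊠ d) ≋-refl (Vec.toList α) (Vec.toList β) denom))

    Φ-· : ∀ x α → Φ (Vec.map (x *_) α) ≈ᵣ x ·ᵣ Φ α
    Φ-· x α = at (≡⇒≋ (cong (_*ₚ denom) (VP.toList-map (x *_) α)))

    Φ-inj : ∀ α β → Φ α ≈ᵣ Φ β → α ≡ β
    Φ-inj α β h = toList-injective α β (cancelʳ denom-nonzero ⟨ h ⟩)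

    -- The order of z − b in denom is m, and no irreducible of degree ≥ 2 divides it.
    Φ-ValGe-linear : ∀ α p b → p ≈ₚ lin (- b) 1# → ValGe p (Φ α) (ℤ.- (+ m))
    Φ-ValGe-linear α p b p≈z-b e zero _ _ = ∣⇒∣ₚ (1∣ (Vec.toList α))
    Φ-ValGe-linear α p b p≈z-b e (suc e′) pᵉ∣denom e′≡e-m =
      ⊥-elim (NP.<⇒≱ (NP.≤-trans (s≤s (NP.m≤n+m m e′)) (NP.≤-reflexive (sym (+e′≡+e-m⇒e≡e′+m e (suc e′) m e′≡e-m))))
        (z-minus-multiplicity b m e (∣-cong (^-cong e ⟨ p≈z-b ⟩) ≋-refl (∣ₚ⇒∣ pᵉ∣denom))))

    Φ-ValGe-nonlinear : ∀ α p k → Monic p (suc k) → Irreducible p → NotLinear p → ValGe p (Φ α) (ℤ.- (+ 0))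
    Φ-ValGe-nonlinear α p k mp ip nl zero e′ _ e′≡0 =
      subst (λ x → (p ^ₚ x) ∣ₚ Vec.toList α) (ZP.+-injective (sym e′≡0)) (∣⇒∣ₚ (1∣ (Vec.toList α)))
    Φ-ValGe-nonlinear α p k mp ip nl (suc e) e′ pᵉ∣denom _ = ⊥-elim (nonlinear-∤-z^q-z {p} {k} mp ip nl m e (∣ₚ⇒∣ pᵉ∣denom))

    Φ-ValGe : ∀ α p → MonicIrreducible p → ∀ c → DivCoeff (+ m) p c → ValGe p (Φ α) (ℤ.- c)
    Φ-ValGe α p mi c (inj₁ (b , p≈z-b , refl)) = Φ-ValGe-linear α p b p≈z-b
    Φ-ValGe α p mi c (inj₂ (nl , refl)) with monicIrreducible⇒ {p} mi
    ... | k , mp , ip = Φ-ValGe-nonlinear α p k mp ip nl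

    Φ-ValInfGe : ∀ α → ValInfGe (Φ α) (+ n)
    Φ-ValInfGe α with degView (Vec.toList α)
    ... | inj₁ α≈0 = inj₁ (at α≈0)
    ... | inj₂ (d , hα) = inj₂ (d , m ℕ.* q , hα , HasDeg-denom ,
            ℤ.+≤+ (NP.≤-trans (NP.+-monoˡ-≤ n (HasDeg-toList α hα)) (NP.≤-reflexive t+n≡mq)))

    Φ-into : ∀ α → InH0 (+ m) (+ n) (Φ α)
    Φ-into α = (λ e → denom-nonzero ⟨ e ⟩) , Φ-ValGe α , Φ-ValInfGe α

    z-minus^m∣denom : ∀ {p} b → p ≋ z-minus b → (p ^ₚ m) ∣ denom
    z-minus^m∣denom {p} b p≈z-b with z^q-z-factor b
    ... | R , z^q-z≈[z-b]R , _ =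
      ∣-cong (^-cong m (≋-sym p≈z-b)) (≋-sym (≋-trans (^-cong m z^q-z≈[z-b]R) (pow-* (z-minus b) R m)))
        (∣-* (z-minus b ^ₚ m) (R ^ₚ m))

    ⇒MonicIrreducible : ∀ {p k} → Monic p (suc k) → Irreducible p → MonicIrreducible p
    ⇒MonicIrreducible {p} {k} mp ip = k , proj₁ mp , proj₂ mp , λ r s e → ip r s ⟨ e ⟩

    -- By the valuation conditions at the finite points, every prime power dividing h divides g·denom.
    denominator-∣ : ∀ g {h dh} → HasDeg h dh →
      (∀ p → MonicIrreducible p → ∀ c → DivCoeff (+ m) p c → ValGe p (g / h) (ℤ.- c)) → h ∣ (g *ₚ denom)
    denominator-∣ g {h} hh V = prime-powers⇒∣ hh (g *ₚ denom) powers
      where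
      powers : PrimePowersDivide h (g *ₚ denom)
      powers p zero mp ip e pᵉ∣h with e NP.≤? m
      ... | yes e≤m = ∣-mulˡ g (∣-trans (^-∣-^ p e≤m) (z-minus^m∣denom (- coeff p 0) ⟨ monic-deg1⇒linear {p} mp ⟩))
      ... | no e≰m = ∣-cong (≋-sym (≋-trans (≡⇒≋ (cong (p ^ₚ_) (sym e′+m≡e))) (pow-+ p (e ∸ m) m))) (≋-refl {g *ₚ denom})
                       (*-pres-∣ pᵉ⁻ᵐ∣g (z-minus^m∣denom (- coeff p 0) ⟨ monic-deg1⇒linear {p} mp ⟩))
        where
        e′+m≡e : e ∸ m ℕ.+ m ≡ e
        e′+m≡e = NP.m∸n+n≡m (NP.<⇒≤ (NP.≰⇒> e≰m))
        pᵉ⁻ᵐ∣g : (p ^ₚ (e ∸ m)) ∣ g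
        pᵉ⁻ᵐ∣g = ∣ₚ⇒∣ (V p (⇒MonicIrreducible {p} mp ip) (+ m) (inj₁ (- coeff p 0 , monic-deg1⇒linear {p} mp , refl)) e (e ∸ m) (∣⇒∣ₚ pᵉ∣h)
                  (subst (λ x → + (e ∸ m) ≡ + x ℤ.+ ℤ.- (+ m)) e′+m≡e (+e≡+[e+k]-k (e ∸ m) m)))
      powers p (suc k) mp ip e pᵉ∣h =
        ∣-mulʳ denom (∣ₚ⇒∣ {p ^ₚ e} {g} (V p (⇒MonicIrreducible {p} mp ip) (+ 0) (inj₂ (monic-deg≥2⇒NotLinear {p} {k} mp , refl))
          e e (∣⇒∣ₚ pᵉ∣h) (cong +_ (sym (NP.+-identityʳ e)))))

    -- deg P = deg g + mq − deg h ≤ mq − n = t.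
    quotient-DegLe : ∀ {g h P dh} → HasDeg h dh → ValInfGe (g / h) (+ n) → g *ₚ denom ≋ h *ₚ P → DegLe P t
    quotient-DegLe {g} {h} {P} {dh} hh I g·denom≈hP with degView P
    ... | inj₁ P≈0 = λ j _ → at P≈0 j
    ... | inj₂ (dP , hP) = λ j dP<j → proj₂ hP j (NP.≤-<-trans (dP≤t I) dP<j)
      where
      dP≤t : ValInfGe (g / h) (+ n) → dP ≤ t
      dP≤t (inj₁ g≈0) = ⊥-elim (nonzero-* {h} {P} (HasDeg⇒nonzero {h} hh) (HasDeg⇒nonzero {P} hP)
        (≋-trans (≋-sym g·denom≈hP) (*-congʳ {g} {[]} denom ⟨ g≈0 ⟩)))
      dP≤t (inj₂ (dg , dh′ , hg , hh′ , dg+n≤dh′)) = NP.+-cancelˡ-≤ dh dP t (begin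
        dh ℕ.+ dP         ≡⟨ deg-unique {h *ₚ P} (HasDeg-* {h} {P} hh hP)
                               (HasDeg-cong {g *ₚ denom} g·denom≈hP (HasDeg-* {g} {denom} hg HasDeg-denom)) ⟩
        dg ℕ.+ m ℕ.* q    ≡⟨ cong (dg ℕ.+_) (sym t+n≡mq) ⟩
        dg ℕ.+ (t ℕ.+ n)  ≡⟨ trans (cong (dg ℕ.+_) (NP.+-comm t n)) (sym (NP.+-assoc dg n t)) ⟩
        dg ℕ.+ n ℕ.+ t    ≤⟨ NP.+-monoˡ-≤ t (subst (dg ℕ.+ n ≤_) (deg-unique {h} hh′ hh) (ZP.drop‿+≤+ dg+n≤dh′)) ⟩
        dh ℕ.+ t          ∎)
        where open NP.≤-Reasoning

    Φ-surj : ∀ f → InH0 (+ m) (+ n) f → Σ (Sym t) (λ α → Φ α ≈ᵣ f)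
    Φ-surj (g / h) (h≢0 , V , I) with degView h
    ... | inj₁ h≈0 = ⊥-elim (h≢0 (at h≈0))
    ... | inj₂ (dh , hh) with denominator-∣ g {h} hh V
    ...   | P , g·denom≈hP = α , at (begin
      Vec.toList α *ₚ h ≈⟨ *-congʳ {Vec.toList α} {P} h (tabulate-coeff t P (quotient-DegLe {g} {h} {P} hh I g·denom≈hP)) ⟩
      P *ₚ h           ≈⟨ *ₚ-comm P h ⟩
      h *ₚ P           ≈⟨ ≋-sym g·denom≈hP ⟩
      g *ₚ denom       ∎)
      where
      open ≋R
      α : Sym t
      α = Vec.tabulate (λ j → coeff P (toℕ j))

    Φ-equiv : ∀ γ α → Φ (symAct t (ℤ.- (+ m)) γ α) ≈ᵣ slash (+ (m ℕ.+ n)) γ (Φ α)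
    Φ-equiv γ α = at (begin
      T *ₚ ((hom denom (length denom) *ₚ w ^ₚ length α′) *ₚ w ^ₚ (m ℕ.+ n))
        ≈⟨ *-cong (toList-symAct t (ℤ.- (+ m)) α)
             (*-cong (*-cong (hom-length denom (m ℕ.* q) HasDeg-denom) (≡⇒≋ (cong (w ^ₚ_) (VP.length-toList α))))
               (pow-+ w m n)) ⟩
      (constₚ c *ₚ H) *ₚ ((G *ₚ w ^ₚ e *ₚ (w *ₚ w ^ₚ t)) *ₚ (w ^ₚ m *ₚ w ^ₚ n))
        ≈⟨ PS.solve 8 (λ k h g we w wt wm wn → (k ⊠ h) ⊠ ((g ⊠ we ⊠ (w ⊠ wt)) ⊠ (wm ⊠ wn)) ≐ (k ⊠ (g ⊠ wm)) ⊠ (h ⊠ w ⊠ (we ⊠ (wt ⊠ wn))))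
             ≋-refl (constₚ c) H G (w ^ₚ e) w (w ^ₚ t) (w ^ₚ m) (w ^ₚ n) ⟩
      (constₚ c *ₚ (G *ₚ w ^ₚ m)) *ₚ (H *ₚ w *ₚ (w ^ₚ e *ₚ (w ^ₚ t *ₚ w ^ₚ n)))
        ≈⟨ *-cong (*-congˡ (constₚ c) (hom-z^q-z-^ m)) (*-congˡ (H *ₚ w) w-powers) ⟩
      (constₚ c *ₚ (constₚ (det γ ^ m) *ₚ denom)) *ₚ (H *ₚ w *ₚ w ^ₚ length denom)
        ≈⟨ *-congʳ (H *ₚ w *ₚ w ^ₚ length denom) scalar-cancels ⟩
      denom *ₚ (H *ₚ w *ₚ w ^ₚ length denom)
        ≈⟨ ≋-trans (*ₚ-comm denom _) (*-congʳ denom (*-congʳ (w ^ₚ length denom) (≋-sym (hom-toList α)))) ⟩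
      (hom α′ (length α′) *ₚ w ^ₚ length denom) *ₚ denom ∎)
      where
      open Action γ
      open ≋R
      α′ : Poly
      α′ = Vec.toList α
      T : Poly
      T = Vec.toList (symAct t (ℤ.- (+ m)) γ α)
      c : Carrier
      c = detPow γ (ℤ.- (+ m))
      H G : Poly
      H = hom α′ t
      G = hom denom (m ℕ.* q)
      e : ℕ
      e = length denom ∸ m ℕ.* q
      w-powers : w ^ₚ e *ₚ (w ^ₚ t *ₚ w ^ₚ n) ≋ w ^ₚ length denom
      w-powers = ≋-trans (*-congˡ (w ^ₚ e) (≋-sym (pow-+ w t n))) (≋-trans (≋-sym (pow-+ w e (t ℕ.+ n)))
        (≡⇒≋ (cong (w ^ₚ_) (trans (cong (e ℕ.+_) t+n≡mq) (NP.m∸n+n≡m (HasDeg≤length {denom} HasDeg-denom))))))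
      scalar-cancels : constₚ c *ₚ (constₚ (det γ ^ m) *ₚ denom) ≋ denom
      scalar-cancels = ≋-trans (≋-sym (*ₚ-assoc (constₚ c) (constₚ (det γ ^ m)) denom))
        (≋-trans (*-congʳ denom (≋-trans (≋-sym (constₚ-* c (det γ ^ m))) (≡⇒≋ (cong constₚ (detPow-inverse γ m)))))
          (*-identityˡₚ denom))

    sym≅H0 : RepIso (+ (m ℕ.+ n)) t (ℤ.- (+ m)) (+ m) (+ n)
    sym≅H0 = record
      { Φ = Φ ; Φ-into = Φ-into ; Φ-+ = Φ-+ ; Φ-· = Φ-· ; Φ-inj = Φ-inj ; Φ-surj = Φ-surj ; Φ-equiv = Φ-equiv }

open import Data.Integer using (ℤ; +_; _+_; _-_; _*_)
import Data.Integer as ℤ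
import Data.Integer.Properties as ZP
open import Data.Integer.Solver using (module +-*-Solver)
open +-*-Solver using (solve; _:+_; _:*_; _:-_; :-_; _:=_; con)

RepIso-resp : ∀ {q} {𝔽 : FiniteField q} {k k′ t s s′ m m′ n n′} →
  k ≡ k′ → s ≡ s′ → m ≡ m′ → n ≡ n′ → FF.RepIso 𝔽 k′ t s′ m′ n′ → FF.RepIso 𝔽 k t s m n
RepIso-resp refl refl refl refl iso = iso

balance-halved : ∀ (Q h : ℤ) (i e t : ℕ) →
  + 2 * + t ≡ (Q - + 1) * (+ 2 * h + + e) - + e * (Q + + 1) - + 2 * (+ i * (Q + + 1)) →
  (Q - + 1) * (h - + i) ≡ + (t ℕ.+ e ℕ.+ 2 ℕ.* i)
balance-halved Q h i e t ht = ZP.*-cancelˡ-≡ (+ 2) _ _ (begin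
  + 2 * ((Q - + 1) * (h - + i))
    ≡⟨ solve 4 (λ Q h i e → con (+ 2) :* ((Q :- con (+ 1)) :* (h :- i))
         := ((Q :- con (+ 1)) :* (con (+ 2) :* h :+ e) :- e :* (Q :+ con (+ 1)) :- con (+ 2) :* (i :* (Q :+ con (+ 1))))
            :+ con (+ 2) :* (e :+ con (+ 2) :* i)) refl Q h (+ i) (+ e) ⟩
  (Q - + 1) * (+ 2 * h + + e) - + e * (Q + + 1) - + 2 * (+ i * (Q + + 1)) + + 2 * (+ e + + 2 * + i)
    ≡⟨ cong (_+ + 2 * (+ e + + 2 * + i)) (sym ht) ⟩
  + 2 * + t + + 2 * (+ e + + 2 * + i)
    ≡⟨ solve 3 (λ t e i → con (+ 2) :* t :+ con (+ 2) :* (e :+ con (+ 2) :* i) := con (+ 2) :* (t :+ e :+ con (+ 2) :* i))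
         refl (+ t) (+ e) (+ i) ⟩
  + 2 * (+ t + + e + + 2 * + i)
    ≡⟨ cong (λ x → + 2 * (+ (t ℕ.+ e) + x)) (sym (ZP.pos-* 2 i)) ⟩
  + 2 * + (t ℕ.+ e ℕ.+ 2 ℕ.* i) ∎)
  where open ≡-Reasoning

nonneg-of-positive-multiple : ∀ a (j : ℤ) r → + suc a * j ≡ + r → Σ ℕ (λ m → j ≡ + m)
nonneg-of-positive-multiple a (+ m) r _ = m , refl
nonneg-of-positive-multiple a ℤ.-[1+ x ] r ()

balanced-weights : ∀ q′ (h : ℤ) (i e t : ℕ) → + suc q′ * (h - + i) ≡ + (t ℕ.+ e ℕ.+ 2 ℕ.* i) →
  Σ ℕ (λ m → (h ≡ + m + + i) × (t ℕ.+ (m ℕ.+ (e ℕ.+ 2 ℕ.* i)) ≡ m ℕ.* suc (suc q′)))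
balanced-weights q′ h i e t eq with nonneg-of-positive-multiple q′ (h - + i) _ eq
... | m , h-i≡m = m , h≡m+i , t+n≡mq
  where
  h≡m+i : h ≡ + m + + i
  h≡m+i = trans (solve 2 (λ h i → h := (h :- i) :+ i) refl h (+ i)) (cong (_+ + i) h-i≡m)
  slope : suc q′ ℕ.* m ≡ t ℕ.+ e ℕ.+ 2 ℕ.* i
  slope = ZP.+-injective (trans (ZP.pos-* (suc q′) m) (trans (cong (+ suc q′ *_) (sym h-i≡m)) eq))
  t+n≡mq : t ℕ.+ (m ℕ.+ (e ℕ.+ 2 ℕ.* i)) ≡ m ℕ.* suc (suc q′)
  t+n≡mq = begin
    t ℕ.+ (m ℕ.+ (e ℕ.+ 2 ℕ.* i)) ≡⟨ regroup ⟩
    m ℕ.+ (t ℕ.+ e ℕ.+ 2 ℕ.* i)  ≡⟨ cong (m ℕ.+_) (sym slope) ⟩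
    m ℕ.+ suc q′ ℕ.* m           ≡⟨ NP.*-comm (suc (suc q′)) m ⟩
    m ℕ.* suc (suc q′)           ∎
    where
    open ≡-Reasoning
    regroup : t ℕ.+ (m ℕ.+ (e ℕ.+ 2 ℕ.* i)) ≡ m ℕ.+ (t ℕ.+ e ℕ.+ 2 ℕ.* i)
    regroup = trans (sym (NP.+-assoc t m _)) (trans (cong (ℕ._+ (e ℕ.+ 2 ℕ.* i)) (NP.+-comm t m))
                (trans (NP.+-assoc m t _) (cong (m ℕ.+_) (sym (NP.+-assoc t e _)))))

sym≅H0-at-weights : ∀ {q} (𝔽 : FiniteField q) (m i e t : ℕ) → t ℕ.+ (m ℕ.+ (e ℕ.+ 2 ℕ.* i)) ≡ m ℕ.* q →
  let h = + m + + i in FF.RepIso 𝔽 (+ 2 * h + + e) t (+ i - h) (h - + i) (h + + e + + i)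
sym≅H0-at-weights 𝔽 m i e t t+n≡mq =
  RepIso-resp k≡m+n (solve 2 (λ m i → i :- (m :+ i) := :- m) refl (+ m) (+ i))
    (solve 2 (λ m i → m :+ i :- i := m) refl (+ m) (+ i)) h+e+i≡n
    (SymToH0.Iso.sym≅H0 𝔽 m (m ℕ.+ (e ℕ.+ 2 ℕ.* i)) t t+n≡mq)
  where
  2i≡ : + 2 * + i ≡ + (2 ℕ.* i)
  2i≡ = sym (ZP.pos-* 2 i)
  k≡m+n : + 2 * (+ m + + i) + + e ≡ + (m ℕ.+ (m ℕ.+ (e ℕ.+ 2 ℕ.* i)))
  k≡m+n = trans (solve 3 (λ m i e → con (+ 2) :* (m :+ i) :+ e := m :+ (m :+ (e :+ con (+ 2) :* i))) refl (+ m) (+ i) (+ e))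
            (cong (λ x → + m + (+ m + (+ e + x))) 2i≡)
  h+e+i≡n : + m + + i + + e + + i ≡ + (m ℕ.+ (e ℕ.+ 2 ℕ.* i))
  h+e+i≡n = trans (solve 3 (λ m i e → m :+ i :+ e :+ i := m :+ (e :+ con (+ 2) :* i)) refl (+ m) (+ i) (+ e))
              (cong (λ x → + m + (+ e + x)) 2i≡)

-- e = 0 is the case of even k, e = 1 that of odd k.
sym≅H0-balanced : ∀ {q} (𝔽 : FiniteField q) (h : ℤ) (i e t : ℕ) →
  + 2 * + t ≡ (+ q - + 1) * (+ 2 * h + + e) - + e * (+ q + + 1) - + 2 * (+ i * (+ q + + 1)) →
  FF.RepIso 𝔽 (+ 2 * h + + e) t (+ i - h) (h - + i) (h + + e + + i)
sym≅H0-balanced {q} 𝔽 h i e t ht with SymToH0.q≡2+ 𝔽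
... | q′ , refl = conclude (balanced-weights q′ h i e t (balance-halved (+ q) h i e t ht))
  where
  conclude : Σ ℕ (λ m → (h ≡ + m + + i) × (t ℕ.+ (m ℕ.+ (e ℕ.+ 2 ℕ.* i)) ≡ m ℕ.* q)) →
    FF.RepIso 𝔽 (+ 2 * h + + e) t (+ i - h) (h - + i) (h + + e + + i)
  conclude (m , h≡m+i , t+n≡mq) =
    subst (λ h → FF.RepIso 𝔽 (+ 2 * h + + e) t (+ i - h) (h - + i) (h + + e + + i)) (sym h≡m+i)
      (sym≅H0-at-weights 𝔽 m i e t t+n≡mq)

lemma3p2 : (q : ℕ) (𝔽 : FiniteField q) (k : ℤ) (i : ℕ) →
    ((h : ℤ) → k ≡ + 2 * h → (t : ℕ) →
    + 2 * + t ≡ (+ q - + 1) * k - + 2 * (+ i * (+ q + + 1)) →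
    FF.RepIso 𝔽 k t (+ i - h) (h - + i) (h + + i))
    × ((h : ℤ) → k ≡ + 2 * h + + 1 → (t : ℕ) →
    + 2 * + t ≡ (+ q - + 1) * k - (+ q + + 1) - + 2 * (+ i * (+ q + + 1)) →
    FF.RepIso 𝔽 k t (+ i - h) (h - + i) (h + + 1 + + i))
lemma3p2 q 𝔽 k i = even k , odd k
  where
  even : ∀ k (h : ℤ) → k ≡ + 2 * h → (t : ℕ) →
    + 2 * + t ≡ (+ q - + 1) * k - + 2 * (+ i * (+ q + + 1)) →
    FF.RepIso 𝔽 k t (+ i - h) (h - + i) (h + + i)
  even _ h refl t ht =
    RepIso-resp (sym (ZP.+-identityʳ _)) refl refl (cong (_+ + i) (sym (ZP.+-identityʳ h)))
      (sym≅H0-balanced 𝔽 h i 0 t (trans ht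
        (solve 3 (λ Q h i → (Q :- con (+ 1)) :* (con (+ 2) :* h) :- con (+ 2) :* (i :* (Q :+ con (+ 1)))
           := (Q :- con (+ 1)) :* (con (+ 2) :* h :+ con (+ 0)) :- con (+ 0) :* (Q :+ con (+ 1)) :- con (+ 2) :* (i :* (Q :+ con (+ 1))))
           refl (+ q) h (+ i))))
  odd : ∀ k (h : ℤ) → k ≡ + 2 * h + + 1 → (t : ℕ) →
    + 2 * + t ≡ (+ q - + 1) * k - (+ q + + 1) - + 2 * (+ i * (+ q + + 1)) →
    FF.RepIso 𝔽 k t (+ i - h) (h - + i) (h + + 1 + + i)
  odd _ h refl t ht =
    sym≅H0-balanced 𝔽 h i 1 t (trans ht
      (solve 3 (λ Q h i → (Q :- con (+ 1)) :* (con (+ 2) :* h :+ con (+ 1)) :- (Q :+ con (+ 1)) :- con (+ 2) :* (i :* (Q :+ con (+ 1)))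
         := (Q :- con (+ 1)) :* (con (+ 2) :* h :+ con (+ 1)) :- con (+ 1) :* (Q :+ con (+ 1)) :- con (+ 2) :* (i :* (Q :+ con (+ 1))))
         refl (+ q) h (+ i)))
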